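{- For $m \geq 2$ and $n \geq 1$, $$\sum_{k=0}^{(m-1)(n-1)}\vert \mathrm{Inc}_k(m \times n) \vert=N_{m,n}(2),$$ i.e. the total number of increasing tableaux of shape $m \times n$ equals the small $m$-Schröder number $N_{m,n}(2)$.
   Context: For a partition $\lambda$ of $N$, an increasing $\lambda$-tableau is a filling of the Young diagram of $\lambda$ with positive integers such that rows and columns are strictly increasing and, if $N-k$ is the largest entry, every integer $1,\dots,N-k$ appears at least once. $\mathrm{Inc}_k(m\times n)$ denotes the set of increasing tableaux of rectangular shape with $m$ rows and $n$ columns ($N=mn$) whose maximum entry is $mn-k$. Let $\mathcal{C}(m,n)$ be the set of lattice paths in $\mathbb{R}^m$ from $(0,\dots,0)$ to $(n,\dots,n)$ using unit steps $X_1=(1,0,\dots,0),\dots,X_m=(0,\dots,0,1)$ and staying in $\{0\le x_m\le\cdots\le x_1\}$. An ascent of $P=\epsilon_1\cdots\epsilon_{mn}$ is an index $i$ with $\epsilon_{i-1}\epsilon_i=X_jX_r$, $r<j$. $N(m,n,\ell)$ is the number of paths in $\mathcal{C}(m,n)$ with exactly $\ell$ ascents, and the $m$-Narayana polynomial is $N_{m,n}(t)=\sum_{\ell=0}^{(m-1)(n-1)}N(m,n,\ell)t^\ell$. -}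

module Defs where

open import Data.Bool using (Bool; true; false; _∧_; _∨_; T; if_then_else_)
open import Data.Nat using (ℕ; zero; suc; _+_; _*_; _∸_; _<ᵇ_; _≡ᵇ_; _≤ᵇ_)
open import Data.Fin using (Fin; toℕ)
open import Data.Vec using (Vec; lookup; toList)
open import Data.List using (List; []; _∷_; take; length)
open import Data.Product using (Σ)

allFin : (n : ℕ) → (Fin n → Bool) → Bool
allFin zero    p = true
allFin (suc n) p = p Fin.zero ∧ allFin n (λ i → p (Fin.suc i))

anyFin : (n : ℕ) → (Fin n → Bool) → Bool
anyFin zero    p = false
anyFin (suc n) p = p Fin.zero ∨ anyFin n (λ i → p (Fin.suc i))

allBelow : ℕ → (ℕ → Bool) → Bool
allBelow zero    p = true
allBelow (suc b) p = allBelow b p ∧ p b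

_⇒ᵇ_ : Bool → Bool → Bool
false ⇒ᵇ _ = true
true  ⇒ᵇ b = b

sumTo : ℕ → (ℕ → ℕ) → ℕ
sumTo zero    f = f 0
sumTo (suc b) f = sumTo b f + f (suc b)

entry : ∀ {m n} → Vec (Vec ℕ n) m → Fin m → Fin n → ℕ
entry t i j = lookup (lookup t i) j

-- isInc m n k t : t is an increasing tableau of shape m×n whose maximum
-- entry is mn−k, i.e. entries positive, rows and columns strictly
-- increasing, all entries ≤ mn−k, and every value 1,…,mn−k occurs.
isInc : (m n k : ℕ) → Vec (Vec ℕ n) m → Bool
isInc m n k t =
  allFin m (λ i → allFin n (λ j → 0 <ᵇ entry t i j))
  ∧ allFin m (λ i → allFin n (λ j → allFin n (λ j' →
       (toℕ j <ᵇ toℕ j') ⇒ᵇ (entry t i j <ᵇ entry t i j'))))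
  ∧ allFin m (λ i → allFin m (λ i' → allFin n (λ j →
       (toℕ i <ᵇ toℕ i') ⇒ᵇ (entry t i j <ᵇ entry t i' j))))
  ∧ allFin m (λ i → allFin n (λ j → entry t i j ≤ᵇ (m * n ∸ k)))
  ∧ allBelow (m * n ∸ k) (λ v →
       anyFin m (λ i → anyFin n (λ j → entry t i j ≡ᵇ suc v)))

Inc : (m n k : ℕ) → Set
Inc m n k = Σ (Vec (Vec ℕ n) m) (λ t → T (isInc m n k t))

-- Lattice paths in ℝ^m from 0 to (n,…,n), unit steps X_1,…,X_m,
-- staying in {0 ≤ x_m ≤ … ≤ x_1}.
-- A path is the word ε_1 ⋯ ε_{mn} of steps; the step X_{j+1} is coded
-- by j : Fin m.

-- number of occurrences of step j in a word (= coordinate x_{j+1})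
cnt : ∀ {m} → Fin m → List (Fin m) → ℕ
cnt j []      = 0
cnt j (s ∷ w) = (if toℕ s ≡ᵇ toℕ j then 1 else 0) + cnt j w

inRegion : (m : ℕ) → List (Fin m) → Bool
inRegion m w = allFin m (λ j → allFin m (λ j' →
  (toℕ j <ᵇ toℕ j') ⇒ᵇ (cnt j' w ≤ᵇ cnt j w)))

isPath : (m n : ℕ) → Vec (Fin m) (m * n) → Bool
isPath m n p =
  allBelow (suc (m * n)) (λ l → inRegion m (take l (toList p)))
  ∧ allFin m (λ j → cnt j (toList p) ≡ᵇ n)

ascents : ∀ {m} → List (Fin m) → ℕ
ascents []              = 0
ascents (a ∷ [])        = 0
ascents (a ∷ b ∷ w)     = (if toℕ b <ᵇ toℕ a then 1 else 0) + ascents (b ∷ w)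

-- paths in C(m,n) with exactly ℓ ascents (counted by N(m,n,ℓ))
PathAsc : (m n ℓ : ℕ) → Set
PathAsc m n ℓ = Σ (Vec (Fin m) (m * n))
  (λ p → T (isPath m n p ∧ (ascents (toList p) ≡ᵇ ℓ)))

module Submission where

-- Peel an increasing tableau from its largest entry down: the largest entry V, taken in the
-- topmost row containing it, ends that row, so removing it leaves an increasing tableau of a
-- smaller shape.  The rows of the removed cells, read backwards, form a path in C(m, n).
-- Flag each removed cell whose entry is repeated by the next removed cell; that cell lies in a
-- strictly lower row, so the flags mark a subset of the ascents of the path.  Conversely every
-- path with any subset of marked ascents refills a unique increasing tableau whose largest entry
-- is mn minus the number of marks.  Hence both sides count marked paths, graded by k resp. ℓ;
-- both gradings are at most (m − 1)(n − 1), since the last cell holds at least m + n − 1 and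
-- each of the first m − 1 rows is entered by at most n − 1 ascents.

open import Data.Bool using (Bool; true; false; _∧_; T; if_then_else_)
open import Data.Bool.Properties using (T-∧; T-∨; T-≡; T-irrelevant; ∧-comm)
open import Data.Empty using (⊥; ⊥-elim)
open import Data.Fin using (Fin; toℕ; fromℕ<; inject₁) renaming (zero to fz; suc to fs)
import Data.Fin.Properties as Fin
open import Data.Fin.Permutation using (↔⇒≡)
open import Data.List using (List; []; _∷_; map; length; take; _++_; reverse; foldl)
import Data.List.Properties as List
open import Data.Nat
  using (ℕ; zero; suc; pred; >-nonZero; s≤s⁻¹; _+_; _*_; _∸_; _^_; _≡ᵇ_; _<ᵇ_; _≤ᵇ_; _≤_; _<_; _≟_; _≤?_; _<?_; z≤n; s≤s)
open import Data.Nat.Properties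
open import Algebra.Properties.CommutativeSemigroup +-commutativeSemigroup
  using () renaming (interchange to +-interchange)
open import Data.Nat.Tactic.RingSolver using (solve-∀)
open import Data.Product using (Σ; _×_; _,_; proj₁; proj₂)
open import Data.Product.Function.NonDependent.Propositional using (_×-↔_)
open import Data.Product.Properties using (≡-dec)
open import Data.Sum using (_⊎_; inj₁; inj₂)
open import Data.Sum.Function.Propositional using (_⊎-↔_)
open import Data.Unit using (⊤; tt)
open import Data.Vec using (Vec; []; _∷_; lookup; tabulate; toList; fromList; cast)
import Data.Vec.Properties as Vec
open import Function.Base using (_∘_)
open import Function.Bundles using (_↔_; mk↔ₛ′; Equivalence)
open import Function.Properties.Inverse using (↔-refl; ↔-sym; ↔-trans)
open import Relation.Binary.Definitions using (tri<; tri≈; tri>)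
open import Relation.Binary.PropositionalEquality
open import Relation.Binary.PropositionalEquality.Properties using (subst-subst-sym; subst-sym-subst)
open import Relation.Nullary using (¬_; Dec; does; yes; no)
open import Relation.Nullary.Decidable using (dec-true; dec-false)

open import Defs

T-∧⁻ : ∀ {x y} → T (x ∧ y) → T x × T y
T-∧⁻ {x} = Equivalence.to (T-∧ {x})

T-∧⁺ : ∀ {x y} → T x → T y → T (x ∧ y)
T-∧⁺ {x} p q = Equivalence.from (T-∧ {x}) (p , q)

⇒ᵇ-intro : ∀ {x y} → (T x → T y) → T (x ⇒ᵇ y)
⇒ᵇ-intro {false} _ = tt
⇒ᵇ-intro {true}  f = f tt

⇒ᵇ-elim : ∀ {x y} → T (x ⇒ᵇ y) → T x → T y
⇒ᵇ-elim {true} p _ = p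

allFin-intro : ∀ k (p : Fin k → Bool) → (∀ i → T (p i)) → T (allFin k p)
allFin-intro zero    p h = tt
allFin-intro (suc k) p h = T-∧⁺ (h fz) (allFin-intro k (λ i → p (fs i)) (λ i → h (fs i)))

allFin-elim : ∀ k (p : Fin k → Bool) → T (allFin k p) → ∀ i → T (p i)
allFin-elim (suc k) p h fz     = proj₁ (T-∧⁻ h)
allFin-elim (suc k) p h (fs i) = allFin-elim k (λ i → p (fs i)) (proj₂ (T-∧⁻ {p fz} h)) i

allFin-cong : ∀ k {p q : Fin k → Bool} → (∀ i → p i ≡ q i) → allFin k p ≡ allFin k q
allFin-cong zero    h = refl
allFin-cong (suc k) h = cong₂ _∧_ (h fz) (allFin-cong k (λ i → h (fs i)))

allFin²-intro : ∀ k l (p : Fin k → Fin l → Bool) → (∀ i j → T (p i j)) → T (allFin k (λ i → allFin l (p i)))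
allFin²-intro k l p h = allFin-intro k _ (λ i → allFin-intro l (p i) (h i))

allFin²-elim : ∀ k l (p : Fin k → Fin l → Bool) → T (allFin k (λ i → allFin l (p i))) → ∀ i j → T (p i j)
allFin²-elim k l p h i = allFin-elim l (p i) (allFin-elim k _ h i)

anyFin-intro : ∀ k (p : Fin k → Bool) i → T (p i) → T (anyFin k p)
anyFin-intro (suc k) p fz     h = Equivalence.from (T-∨ {p fz}) (inj₁ h)
anyFin-intro (suc k) p (fs i) h =
  Equivalence.from (T-∨ {p fz}) (inj₂ (anyFin-intro k (λ i → p (fs i)) i h))

anyFin-elim : ∀ k (p : Fin k → Bool) → T (anyFin k p) → Σ (Fin k) (λ i → T (p i))
anyFin-elim (suc k) p h with Equivalence.to (T-∨ {p fz}) h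
... | inj₁ h₀ = fz , h₀
... | inj₂ h₊ with anyFin-elim k (λ i → p (fs i)) h₊
...   | i , hᵢ = fs i , hᵢ

allBelow-intro : ∀ b (p : ℕ → Bool) → (∀ v → v < b → T (p v)) → T (allBelow b p)
allBelow-intro zero    p h = tt
allBelow-intro (suc b) p h = T-∧⁺ (allBelow-intro b p (λ v v<b → h v (m<n⇒m<1+n v<b))) (h b ≤-refl)

allBelow-elim : ∀ b (p : ℕ → Bool) → T (allBelow b p) → ∀ v → v < b → T (p v)
allBelow-elim (suc b) p h v v<1+b with m<1+n⇒m<n∨m≡n v<1+b
... | inj₁ v<b  = allBelow-elim b p (proj₁ (T-∧⁻ h)) v v<b
... | inj₂ refl = proj₂ (T-∧⁻ {allBelow b p} h)

allBelow-cong : ∀ b {p q : ℕ → Bool} → (∀ v → v < b → p v ≡ q v) → allBelow b p ≡ allBelow b q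
allBelow-cong zero    h = refl
allBelow-cong (suc b) h = cong₂ _∧_ (allBelow-cong b (λ v v<b → h v (m<n⇒m<1+n v<b))) (h b ≤-refl)

≡ᵇ-true : ∀ x y → x ≡ y → (x ≡ᵇ y) ≡ true
≡ᵇ-true x y = dec-true (x ≟ y)

≡ᵇ-false : ∀ x y → ¬ x ≡ y → (x ≡ᵇ y) ≡ false
≡ᵇ-false x y = dec-false (x ≟ y)

<ᵇ-true : ∀ x y → x < y → (x <ᵇ y) ≡ true
<ᵇ-true x y = dec-true (x <? y)

<ᵇ-false : ∀ x y → ¬ x < y → (x <ᵇ y) ≡ false
<ᵇ-false x y = dec-false (x <? y)

sumFin : ∀ {k} → (Fin k → ℕ) → ℕ
sumFin {zero}  f = 0
sumFin {suc k} f = f fz + sumFin (λ i → f (fs i))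

sumFin-cong : ∀ {k} {f g : Fin k → ℕ} → (∀ i → f i ≡ g i) → sumFin f ≡ sumFin g
sumFin-cong {zero}  h = refl
sumFin-cong {suc k} h = cong₂ _+_ (h fz) (sumFin-cong (λ i → h (fs i)))

sumFin-const : ∀ k c → sumFin {k} (λ _ → c) ≡ k * c
sumFin-const zero    c = refl
sumFin-const (suc k) c = cong (c +_) (sumFin-const k c)

sumFin-+ : ∀ {k} (f g : Fin k → ℕ) → sumFin (λ i → f i + g i) ≡ sumFin f + sumFin g
sumFin-+ {zero}  f g = refl
sumFin-+ {suc k} f g = begin
  f fz + g fz + sumFin (λ i → f (fs i) + g (fs i))
    ≡⟨ cong (f fz + g fz +_) (sumFin-+ (λ i → f (fs i)) (λ i → g (fs i))) ⟩
  f fz + g fz + (sumFin (λ i → f (fs i)) + sumFin (λ i → g (fs i)))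
    ≡⟨ +-interchange (f fz) (g fz) _ _ ⟩
  f fz + sumFin (λ i → f (fs i)) + (g fz + sumFin (λ i → g (fs i))) ∎
  where open ≡-Reasoning

sumFin-mono : ∀ {k} {f g : Fin k → ℕ} → (∀ i → f i ≤ g i) → sumFin f ≤ sumFin g
sumFin-mono {zero}  h = z≤n
sumFin-mono {suc k} h = +-mono-≤ (h fz) (sumFin-mono (λ i → h (fs i)))

sumFin-mono-< : ∀ {k} {f g : Fin k → ℕ} (r : Fin k) → (∀ i → f i ≤ g i) → f r < g r →
  sumFin f < sumFin g
sumFin-mono-< {suc k} fz     h fr<gr = +-mono-<-≤ fr<gr (sumFin-mono (λ i → h (fs i)))
sumFin-mono-< {suc k} (fs r) h fr<gr = +-mono-≤-< (h fz) (sumFin-mono-< r (λ i → h (fs i)) fr<gr)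

sumFin≡0⇒≡0 : ∀ {k} (f : Fin k → ℕ) → sumFin f ≡ 0 → ∀ i → f i ≡ 0
sumFin≡0⇒≡0 {suc k} f e fz     = m+n≡0⇒m≡0 (f fz) e
sumFin≡0⇒≡0 {suc k} f e (fs i) = sumFin≡0⇒≡0 (λ i → f (fs i)) (m+n≡0⇒n≡0 (f fz) e) i

sumFin-positive : ∀ {k} (f : Fin k → ℕ) {N} → sumFin f ≡ suc N → Σ (Fin k) (λ i → 1 ≤ f i)
sumFin-positive {suc k} f e with f fz in f₀
... | suc _ = fz , subst (1 ≤_) (sym f₀) (s≤s z≤n)
... | zero  with sumFin-positive (λ i → f (fs i)) e
...   | i , fᵢ>0 = fs i , fᵢ>0

sumFin-bump : ∀ {k} (g h : Fin k → ℕ) (r : Fin k) →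
  (∀ i → ¬ i ≡ r → g i ≡ h i) → g r ≡ suc (h r) → sumFin g ≡ suc (sumFin h)
sumFin-bump {suc k} g h fz     off on = cong₂ _+_ on (sumFin-cong (λ i → off (fs i) (λ ())))
sumFin-bump {suc k} g h (fs r) off on =
  trans (cong₂ _+_ (off fz (λ ()))
                   (sumFin-bump (λ i → g (fs i)) (λ i → h (fs i)) r
                      (λ i i≢r → off (fs i) (λ e → i≢r (Fin.suc-injective e))) on))
        (+-suc (h fz) _)

sumFin-indicator : ∀ {k} (x : Fin k) → sumFin {k} (λ i → if toℕ x ≡ᵇ toℕ i then 1 else 0) ≡ 1
sumFin-indicator {suc k} fz     = cong suc (trans (sumFin-const k 0) (*-zeroʳ k))
sumFin-indicator {suc k} (fs x) = sumFin-indicator x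

leastWitness : ∀ {k} (P : Fin k → Set) → (∀ i → Dec (P i)) → (i : Fin k) → P i →
  Σ (Fin k) (λ i* → P i* × (∀ i' → toℕ i' < toℕ i* → ¬ P i'))
leastWitness {suc k} P P? i Pi with P? fz
... | yes P₀ = fz , P₀ , λ _ ()
leastWitness {suc k} P P? fz     P₀ | no ¬P₀ = ⊥-elim (¬P₀ P₀)
leastWitness {suc k} P P? (fs i) Pi | no ¬P₀ with leastWitness (λ i → P (fs i)) (λ i → P? (fs i)) i Pi
... | i* , Pi* , below = fs i* , Pi* , λ { fz _ → ¬P₀ ; (fs i') i'<i* → below i' (s≤s⁻¹ i'<i*) }

⊎-upTo : ℕ → (ℕ → Set) → Set
⊎-upTo zero    F = F 0
⊎-upTo (suc b) F = ⊎-upTo b F ⊎ F (suc b)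

⊎-upTo-cong : ∀ B {F G : ℕ → Set} → (∀ k → F k ↔ G k) → ⊎-upTo B F ↔ ⊎-upTo B G
⊎-upTo-cong zero    F↔G = F↔G 0
⊎-upTo-cong (suc B) F↔G = ⊎-upTo-cong B F↔G ⊎-↔ F↔G (suc B)

⊎-upTo-Fin : ∀ B (c : ℕ → ℕ) → ⊎-upTo B (λ k → Fin (c k)) ↔ Fin (sumTo B c)
⊎-upTo-Fin zero    c = ↔-refl
⊎-upTo-Fin (suc B) c = ↔-trans (⊎-upTo-Fin B c ⊎-↔ ↔-refl) (↔-sym Fin.+↔⊎)

Fibre : {X : Set} → (X → ℕ) → ℕ → Set
Fibre {X} κ k = Σ X (λ x → κ x ≡ k)

⊎-upTo-Fibre : ∀ {X : Set} (κ : X → ℕ) B → ⊎-upTo B (Fibre κ) ↔ Σ X (λ x → κ x ≤ B)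
⊎-upTo-Fibre {X} κ zero = mk↔ₛ′
  (λ { (x , e) → x , ≤-reflexive e }) (λ { (x , κx≤0) → x , n≤0⇒n≡0 κx≤0 })
  (λ { (x , _) → cong (x ,_) (≤-irrelevant _ _) }) (λ { (x , _) → cong (x ,_) (≡-irrelevant _ _) })
⊎-upTo-Fibre {X} κ (suc B) = ↔-trans (⊎-upTo-Fibre κ B ⊎-↔ ↔-refl) split
  where
  to : Σ X (λ x → κ x ≤ B) ⊎ Fibre κ (suc B) → Σ X (λ x → κ x ≤ suc B)
  to (inj₁ (x , κx≤B)) = x , m≤n⇒m≤1+n κx≤B
  to (inj₂ (x , e))    = x , ≤-reflexive e
  from : Σ X (λ x → κ x ≤ suc B) → Σ X (λ x → κ x ≤ B) ⊎ Fibre κ (suc B)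
  from (x , κx≤1+B) with κ x ≤? B
  ... | yes κx≤B = inj₁ (x , κx≤B)
  ... | no  κx≰B = inj₂ (x , ≤-antisym κx≤1+B (≰⇒> κx≰B))
  to∘from : ∀ y → to (from y) ≡ y
  to∘from (x , _) with κ x ≤? B
  ... | yes _ = cong (x ,_) (≤-irrelevant _ _)
  ... | no  _ = cong (x ,_) (≤-irrelevant _ _)
  from∘to : ∀ y → from (to y) ≡ y
  from∘to (inj₁ (x , κx≤B)) with κ x ≤? B
  ... | yes _    = cong (λ p → inj₁ (x , p)) (≤-irrelevant _ _)
  ... | no  κx≰B = ⊥-elim (κx≰B κx≤B)
  from∘to (inj₂ (x , e)) with κ x ≤? B
  ... | yes κx≤B = ⊥-elim (<⇒≱ (≤-reflexive (sym e)) κx≤B)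
  ... | no  _    = cong (λ p → inj₂ (x , p)) (≡-irrelevant _ _)
  split : (Σ X (λ x → κ x ≤ B) ⊎ Fibre κ (suc B)) ↔ Σ X (λ x → κ x ≤ suc B)
  split = mk↔ₛ′ to from to∘from from∘to

⊎-upTo-Fibre-bounded : ∀ {X : Set} (κ : X → ℕ) B → (∀ x → κ x ≤ B) → ⊎-upTo B (Fibre κ) ↔ X
⊎-upTo-Fibre-bounded {X} κ B κ≤B = ↔-trans (⊎-upTo-Fibre κ B) (mk↔ₛ′
  proj₁ (λ x → x , κ≤B x) (λ _ → refl) (λ { (x , _) → cong (x ,_) (≤-irrelevant _ _) }))

sumTo-double-count : ∀ {X : Set} (κ₁ κ₂ : X → ℕ) B (c₁ c₂ : ℕ → ℕ) →
  (∀ x → κ₁ x ≤ B) → (∀ x → κ₂ x ≤ B) →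
  (∀ k → Fibre κ₁ k ↔ Fin (c₁ k)) → (∀ k → Fibre κ₂ k ↔ Fin (c₂ k)) →
  sumTo B c₁ ≡ sumTo B c₂
sumTo-double-count κ₁ κ₂ B c₁ c₂ κ₁≤B κ₂≤B fib₁ fib₂ = ↔⇒≡ (
  ↔-trans (↔-sym (⊎-upTo-Fin B c₁)) (
  ↔-trans (⊎-upTo-cong B (λ k → ↔-sym (fib₁ k))) (
  ↔-trans (⊎-upTo-Fibre-bounded κ₁ B κ₁≤B) (
  ↔-trans (↔-sym (⊎-upTo-Fibre-bounded κ₂ B κ₂≤B)) (
  ↔-trans (⊎-upTo-cong B fib₂) (
  ⊎-upTo-Fin B c₂))))))

Σ-T-≡ : ∀ {A : Set} {P : A → Bool} {x y : A} (x≡y : x ≡ y) {p : T (P x)} {q : T (P y)} →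
  _≡_ {A = Σ A (T ∘ P)} (x , p) (y , q)
Σ-T-≡ {x = x} refl {p} {q} = cong (x ,_) (T-irrelevant p q)

Fibre-≡ : ∀ {X : Set} {κ : X → ℕ} {k} {x y : X} (x≡y : x ≡ y) {p : κ x ≡ k} {q : κ y ≡ k} →
  _≡_ {A = Fibre κ k} (x , p) (y , q)
Fibre-≡ {x = x} refl {p} {q} = cong (x ,_) (≡-irrelevant p q)

Vec-Bool↔Fin-2^ : ∀ ℓ → Vec Bool ℓ ↔ Fin (2 ^ ℓ)
Vec-Bool↔Fin-2^ zero = mk↔ₛ′ (λ _ → fz) (λ _ → []) (λ { fz → refl ; (fs ()) }) (λ { [] → refl })
Vec-Bool↔Fin-2^ (suc ℓ) =
  ↔-trans uncons (↔-trans (↔-sym Fin.2↔Bool ×-↔ Vec-Bool↔Fin-2^ ℓ) (↔-sym Fin.*↔×))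
  where
  uncons : Vec Bool (suc ℓ) ↔ (Bool × Vec Bool ℓ)
  uncons = mk↔ₛ′ (λ { (x ∷ v) → x , v }) (λ { (x , v) → x ∷ v }) (λ _ → refl) (λ { (_ ∷ _) → refl })

module Tableaux (m n : ℕ) where

  cnt-here : ∀ (j : Fin m) w → cnt j (j ∷ w) ≡ suc (cnt j w)
  cnt-here j w rewrite ≡ᵇ-true (toℕ j) (toℕ j) refl = refl

  cnt-there : ∀ (s j : Fin m) w → ¬ s ≡ j → cnt j (s ∷ w) ≡ cnt j w
  cnt-there s j w s≢j rewrite ≡ᵇ-false (toℕ s) (toℕ j) (λ e → s≢j (Fin.toℕ-injective e)) = refl

  cnt-∷-≤ : ∀ (s j : Fin m) w → cnt j w ≤ cnt j (s ∷ w)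
  cnt-∷-≤ s j w with s Fin.≟ j
  ... | yes refl = subst (cnt j w ≤_) (sym (cnt-here j w)) (n≤1+n _)
  ... | no  s≢j  = ≤-reflexive (sym (cnt-there s j w s≢j))

  <-cnt-∷ : ∀ (r i : Fin m) w (c : ℕ) → c < cnt i (r ∷ w) → (r ≡ i → ¬ c ≡ cnt r w) → c < cnt i w
  <-cnt-∷ r i w c c< c≢ with r Fin.≟ i
  ... | yes refl = ≤∧≢⇒< (s≤s⁻¹ (subst (c <_) (cnt-here r w) c<)) (c≢ refl)
  ... | no  r≢i  = subst (c <_) (cnt-there r i w r≢i) c<

  InRegion : List (Fin m) → Set
  InRegion w = ∀ (j j' : Fin m) → toℕ j < toℕ j' → cnt j' w ≤ cnt j w

  inRegion⇒InRegion : ∀ w → T (inRegion m w) → InRegion w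
  inRegion⇒InRegion w h j j' j<j' =
    ≤ᵇ⇒≤ _ _ (⇒ᵇ-elim (allFin-elim m _ (allFin-elim m _ h j) j') (<⇒<ᵇ j<j'))

  InRegion⇒inRegion : ∀ w → InRegion w → T (inRegion m w)
  InRegion⇒inRegion w h = allFin-intro m _ (λ j → allFin-intro m _ (λ j' →
    ⇒ᵇ-intro (λ j<j' → ≤⇒≤ᵇ (h j j' (<ᵇ⇒< _ _ j<j')))))

  -- Words are stored newest step first, so their tails are the prefixes of the path.
  tailsInRegion : List (Fin m) → Bool
  tailsInRegion []      = true
  tailsInRegion (x ∷ u) = inRegion m (x ∷ u) ∧ tailsInRegion u

  tailsInRegion⇒InRegion : ∀ u → T (tailsInRegion u) → InRegion u
  tailsInRegion⇒InRegion []      _ j j' _ = z≤n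
  tailsInRegion⇒InRegion (x ∷ u) h        = inRegion⇒InRegion (x ∷ u) (proj₁ (T-∧⁻ h))

  tailsInRegion-tail : ∀ x u → T (tailsInRegion (x ∷ u)) → T (tailsInRegion u)
  tailsInRegion-tail x u h = proj₂ (T-∧⁻ {inRegion m (x ∷ u)} h)

  -- A flagged word lists the cells of a tableau from the largest entry down, each cell given
  -- by its row (it is the last filled cell of that row); a set flag means that the cell
  -- repeats the entry of the next cell of the word.
  FlaggedWord : Set
  FlaggedWord = List (Fin m × Bool)

  steps : FlaggedWord → List (Fin m)
  steps = map proj₁

  rowLength : Fin m → FlaggedWord → ℕ
  rowLength i w = cnt i (steps w)

  top : FlaggedWord → ℕ
  top []                = 0
  top ((_ , true)  ∷ w) = top w
  top ((_ , false) ∷ w) = suc (top w)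

  WellFlagged : FlaggedWord → Set
  WellFlagged []                           = ⊤
  WellFlagged ((x , false) ∷ w)            = WellFlagged w
  WellFlagged ((x , true) ∷ [])            = ⊥
  WellFlagged ((x , true) ∷ ((y , b) ∷ w)) = toℕ x < toℕ y × WellFlagged ((y , b) ∷ w)

  HeadBelow : Fin m → FlaggedWord → Set
  HeadBelow i []            = ⊥
  HeadBelow i ((r , _) ∷ _) = toℕ i < toℕ r

  wellFlagged-tail : ∀ s w → WellFlagged (s ∷ w) → WellFlagged w
  wellFlagged-tail (x , false) w       wf = wf
  wellFlagged-tail (x , true)  (y ∷ w) wf = proj₂ wf

  wellFlagged⇒headBelow : ∀ r w → WellFlagged ((r , true) ∷ w) → HeadBelow r w
  wellFlagged⇒headBelow r ((r' , _) ∷ w) (r<r' , _) = r<r'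

  headBelow-< : ∀ {i r} w → toℕ i < toℕ r → HeadBelow r w → HeadBelow i w
  headBelow-< ((_ , _) ∷ _) i<r r<r' = <-trans i<r r<r'

  top-positive : ∀ s w → WellFlagged (s ∷ w) → 1 ≤ top (s ∷ w)
  top-positive (x , false) w       wf = s≤s z≤n
  top-positive (x , true)  (y ∷ w) wf = top-positive y w (proj₂ wf)

  top-≤-∷ : ∀ s w → top w ≤ top (s ∷ w)
  top-≤-∷ (x , false) w = n≤1+n _
  top-≤-∷ (x , true)  w = ≤-refl

  fill : FlaggedWord → Fin m → Fin n → ℕ
  fill []            i j = 0
  fill ((r , b) ∷ w) i j = if (toℕ r ≡ᵇ toℕ i) ∧ (toℕ j ≡ᵇ rowLength r w) then top ((r , b) ∷ w) else fill w i j

  fill-head : ∀ r b w (j : Fin n) → toℕ j ≡ rowLength r w → fill ((r , b) ∷ w) r j ≡ top ((r , b) ∷ w)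
  fill-head r b w j e rewrite ≡ᵇ-true (toℕ r) (toℕ r) refl | ≡ᵇ-true (toℕ j) (rowLength r w) e = refl

  fill-otherRow : ∀ r b w i (j : Fin n) → ¬ r ≡ i → fill ((r , b) ∷ w) i j ≡ fill w i j
  fill-otherRow r b w i j r≢i rewrite ≡ᵇ-false (toℕ r) (toℕ i) (λ e → r≢i (Fin.toℕ-injective e)) = refl

  fill-otherColumn : ∀ r b w i (j : Fin n) → ¬ toℕ j ≡ rowLength r w → fill ((r , b) ∷ w) i j ≡ fill w i j
  fill-otherColumn r b w i j j≢ with toℕ r ≡ᵇ toℕ i
  ... | false = refl
  ... | true rewrite ≡ᵇ-false (toℕ j) (rowLength r w) j≢ = refl

  fill-outside : ∀ w i j → rowLength i w ≤ toℕ j → fill w i j ≡ 0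
  fill-outside []            i j _ = refl
  fill-outside ((r , b) ∷ w) i j len≤j with r Fin.≟ i
  ... | no r≢i = trans (fill-otherRow r b w i j r≢i) (fill-outside w i j (≤-trans (cnt-∷-≤ r i (steps w)) len≤j))
  ... | yes refl with toℕ j ≟ rowLength r w
  ...   | yes e  = ⊥-elim (<⇒≱ (subst (_< cnt r (r ∷ steps w)) (sym e) (≤-reflexive (sym (cnt-here r (steps w))))) len≤j)
  ...   | no j≢  = trans (fill-otherColumn r b w r j j≢) (fill-outside w r j (≤-trans (cnt-∷-≤ r r (steps w)) len≤j))

  fill≤top : ∀ w i j → fill w i j ≤ top w
  fill≤top []            i j = z≤n
  fill≤top ((r , b) ∷ w) i j with r Fin.≟ i
  ... | no r≢i = subst (_≤ top ((r , b) ∷ w)) (sym (fill-otherRow r b w i j r≢i)) (≤-trans (fill≤top w i j) (top-≤-∷ (r , b) w))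
  ... | yes refl with toℕ j ≟ rowLength r w
  ...   | yes e  = ≤-reflexive (fill-head r b w j e)
  ...   | no j≢  = subst (_≤ top ((r , b) ∷ w)) (sym (fill-otherColumn r b w r j j≢))
                     (≤-trans (fill≤top w r j) (top-≤-∷ (r , b) w))

  fill-positive : ∀ w → WellFlagged w → ∀ i j → toℕ j < rowLength i w → 1 ≤ fill w i j
  fill-positive []            wf i j ()
  fill-positive ((r , b) ∷ w) wf i j j<len with r Fin.≟ i
  ... | no r≢i = subst (1 ≤_) (sym (fill-otherRow r b w i j r≢i))
                   (fill-positive w (wellFlagged-tail (r , b) w wf) i j (subst (toℕ j <_) (cnt-there r i (steps w) r≢i) j<len))
  ... | yes refl with toℕ j ≟ rowLength r w
  ...   | yes e  = subst (1 ≤_) (sym (fill-head r b w j e)) (top-positive (r , b) w wf)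
  ...   | no j≢  = subst (1 ≤_) (sym (fill-otherColumn r b w r j j≢))
                     (fill-positive w (wellFlagged-tail (r , b) w wf) r j (<-cnt-∷ r r (steps w) (toℕ j) j<len (λ _ → j≢)))

  fill≡top⇒head≤row : ∀ r b w i j → WellFlagged ((r , b) ∷ w) → fill ((r , b) ∷ w) i j ≡ top ((r , b) ∷ w) →
    toℕ r ≤ toℕ i
  fill≡top⇒head≤row r b w i j wf e with r Fin.≟ i
  ... | yes refl = ≤-refl
  fill≡top⇒head≤row r false w i j wf e | no r≢i =
    ⊥-elim (<⇒≱ (s≤s (fill≤top w i j)) (≤-reflexive (sym (trans (sym (fill-otherRow r false w i j r≢i)) e))))
  fill≡top⇒head≤row r true ((r' , b') ∷ w) i j (r<r' , wf) e | no r≢i =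
    ≤-trans (<⇒≤ r<r') (fill≡top⇒head≤row r' b' w i j wf (trans (sym (fill-otherRow r true ((r' , b') ∷ w) i j r≢i)) e))

  fill<top : ∀ r b w i j → WellFlagged ((r , b) ∷ w) → toℕ i < toℕ r → fill ((r , b) ∷ w) i j < top ((r , b) ∷ w)
  fill<top r b w i j wf i<r = ≤∧≢⇒< (fill≤top ((r , b) ∷ w) i j) (λ e → <⇒≱ i<r (fill≡top⇒head≤row r b w i j wf e))

  fill-tail<top : ∀ r b w i j → WellFlagged ((r , b) ∷ w) → (b ≡ true → HeadBelow i w) → fill w i j < top ((r , b) ∷ w)
  fill-tail<top r false w                i j wf below = s≤s (fill≤top w i j)
  fill-tail<top r true  ((r' , b') ∷ w) i j wf below = fill<top r' b' w i j (proj₂ wf) (below refl)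

  fill-row-increasing : ∀ w → WellFlagged w → ∀ i (j j' : Fin n) → toℕ j < toℕ j' → toℕ j' < rowLength i w →
    fill w i j < fill w i j'
  fill-row-increasing [] wf i j j' j<j' ()
  fill-row-increasing ((r , b) ∷ w) wf i j j' j<j' j'<len with r Fin.≟ i
  ... | no r≢i = subst₂ _<_ (sym (fill-otherRow r b w i j r≢i)) (sym (fill-otherRow r b w i j' r≢i))
                   (fill-row-increasing w (wellFlagged-tail (r , b) w wf) i j j' j<j'
                      (subst (toℕ j' <_) (cnt-there r i (steps w) r≢i) j'<len))
  ... | yes refl with toℕ j' ≟ rowLength r w
  ...   | yes e  = subst₂ _<_ (sym (fill-otherColumn r b w r j (λ e' → <⇒≢ j<j' (trans e' (sym e)))))
                     (sym (fill-head r b w j' e))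
                     (fill-tail<top r b w r j wf λ { refl → wellFlagged⇒headBelow r w wf })
  ...   | no j'≢ = subst₂ _<_ (sym (fill-otherColumn r b w r j (λ e' → <⇒≢ (<-trans j<j' j'<len′) e')))
                     (sym (fill-otherColumn r b w r j' j'≢))
                     (fill-row-increasing w (wellFlagged-tail (r , b) w wf) r j j' j<j' j'<len′)
    where j'<len′ = <-cnt-∷ r r (steps w) (toℕ j') j'<len (λ _ → j'≢)

  fill-column-increasing : ∀ w → WellFlagged w → T (tailsInRegion (steps w)) →
    ∀ (i i' : Fin m) (j : Fin n) → toℕ i < toℕ i' → toℕ j < rowLength i' w → fill w i j < fill w i' j
  fill-column-increasing [] wf reg i i' j i<i' ()
  fill-column-increasing ((r , b) ∷ w) wf reg i i' j i<i' j<len with toℕ j ≟ rowLength r w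
  ... | no j≢ = subst₂ _<_ (sym (fill-otherColumn r b w i j j≢)) (sym (fill-otherColumn r b w i' j j≢))
                  (fill-column-increasing w (wellFlagged-tail (r , b) w wf) (tailsInRegion-tail r (steps w) reg) i i' j i<i'
                     (<-cnt-∷ r i' (steps w) (toℕ j) j<len (λ _ → j≢)))
  ... | yes e with r Fin.≟ i'
  ...   | yes refl = subst₂ _<_ (sym (fill-otherRow r b w i j (λ e' → <⇒≢ i<i' (cong toℕ (sym e')))))
                       (sym (fill-head r b w j e))
                       (fill-tail<top r b w i j wf λ { refl → headBelow-< w i<i' (wellFlagged⇒headBelow r w wf) })
  ...   | no r≢i' with r Fin.≟ i
  ...     | yes refl = ⊥-elim (<⇒≱ (subst (_< rowLength i' w) e j<len′)
                         (tailsInRegion⇒InRegion (steps w) (tailsInRegion-tail r (steps w) reg) r i' i<i'))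
    where j<len′ = subst (toℕ j <_) (cnt-there r i' (steps w) r≢i') j<len
  ...     | no r≢i = subst₂ _<_ (sym (fill-otherRow r b w i j r≢i)) (sym (fill-otherRow r b w i' j r≢i'))
                       (fill-column-increasing w (wellFlagged-tail (r , b) w wf) (tailsInRegion-tail r (steps w) reg) i i' j i<i'
                          (subst (toℕ j <_) (cnt-there r i' (steps w) r≢i') j<len))

  Bounded : FlaggedWord → Set
  Bounded w = ∀ i → rowLength i w ≤ n

  bounded-tail : ∀ s w → Bounded (s ∷ w) → Bounded w
  bounded-tail s w bd i = ≤-trans (cnt-∷-≤ (proj₁ s) i (steps w)) (bd i)

  head-column<n : ∀ r b w → Bounded ((r , b) ∷ w) → rowLength r w < n
  head-column<n r b w bd = subst (_≤ n) (cnt-here r (steps w)) (bd r)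

  headCell : ∀ r b w → Bounded ((r , b) ∷ w) → Σ (Fin n) (λ j → toℕ j ≡ rowLength r w)
  headCell r b w bd = fromℕ< (head-column<n r b w bd) , Fin.toℕ-fromℕ< (head-column<n r b w bd)

  fill-covers : ∀ w → WellFlagged w → Bounded w → ∀ v → 1 ≤ v → v ≤ top w →
    Σ (Fin m) λ i → Σ (Fin n) λ j → toℕ j < rowLength i w × fill w i j ≡ v
  fill-covers [] wf bd v 1≤v v≤0 = ⊥-elim (<⇒≱ 1≤v v≤0)
  fill-covers ((r , b) ∷ w) wf bd v 1≤v v≤top with v ≟ top ((r , b) ∷ w) | headCell r b w bd
  ... | yes refl | j , j≡ =
    r , j , subst (_< rowLength r ((r , b) ∷ w)) (sym j≡) (≤-reflexive (sym (cnt-here r (steps w)))) ,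
    fill-head r b w j j≡
  ... | no v≢ | _ with fill-covers w (wellFlagged-tail (r , b) w wf) (bounded-tail (r , b) w bd) v 1≤v (v≤top-tail b v≤top v≢)
    where
    v≤top-tail : ∀ b → v ≤ top ((r , b) ∷ w) → ¬ v ≡ top ((r , b) ∷ w) → v ≤ top w
    v≤top-tail false v≤ v≢ = s≤s⁻¹ (≤∧≢⇒< v≤ v≢)
    v≤top-tail true  v≤ _  = v≤
  ...   | i , j , j<len , e = i , j , ≤-trans j<len (cnt-∷-≤ r i (steps w)) , trans (notHead (r Fin.≟ i)) e
    where
    notHead : Dec (r ≡ i) → fill ((r , b) ∷ w) i j ≡ fill w i j
    notHead (no r≢i)  = fill-otherRow r b w i j r≢i
    notHead (yes refl) = fill-otherColumn r b w r j (<⇒≢ j<len)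

  -- An increasing filling of the shape sh (rows padded with zeros) whose entries are exactly 1, …, V.
  record IncFilling (f : Fin m → Fin n → ℕ) (sh : Fin m → ℕ) (V : ℕ) : Set where
    field
      positive          : ∀ i j → toℕ j < sh i → 1 ≤ f i j
      vanishes          : ∀ i j → sh i ≤ toℕ j → f i j ≡ 0
      shape≤n           : ∀ i → sh i ≤ n
      shape-antitone    : ∀ (i i' : Fin m) → toℕ i < toℕ i' → sh i' ≤ sh i
      row-increasing    : ∀ i (j j' : Fin n) → toℕ j < toℕ j' → toℕ j' < sh i → f i j < f i j'
      column-increasing : ∀ (i i' : Fin m) j → toℕ i < toℕ i' → toℕ j < sh i' → f i j < f i' j
      bounded           : ∀ i j → f i j ≤ V
      covers            : ∀ v → 1 ≤ v → v ≤ V → Σ (Fin m) λ i → Σ (Fin n) λ j → toℕ j < sh i × f i j ≡ v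

  record Decomposition (f : Fin m → Fin n → ℕ) (sh : Fin m → ℕ) (V : ℕ) : Set where
    constructor decomposition
    field
      word           : FlaggedWord
      word-inRegion  : T (tailsInRegion (steps word))
      word-flags     : WellFlagged word
      word-rowLength : ∀ i → rowLength i word ≡ sh i
      word-top       : top word ≡ V
      word-fill      : ∀ i j → fill word i j ≡ f i j

  positive⇒inShape : ∀ {f : Fin m → Fin n → ℕ} {sh : Fin m → ℕ} → (∀ i j → sh i ≤ toℕ j → f i j ≡ 0) →
    ∀ i j → 1 ≤ f i j → toℕ j < sh i
  positive⇒inShape {sh = sh} vanishes i j 1≤f with sh i ≤? toℕ j
  ... | yes sh≤j = ⊥-elim (<⇒≢ 1≤f (sym (vanishes i j sh≤j)))
  ... | no  sh≰j = ≰⇒> sh≰j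

  fill-incFilling : ∀ w {sh} → WellFlagged w → T (tailsInRegion (steps w)) → (∀ i → rowLength i w ≡ sh i) →
    (∀ i → sh i ≤ n) → IncFilling (fill w) sh (top w)
  fill-incFilling w {sh} wf reg len≡ sh≤n = record
    { positive          = λ i j j<sh → fill-positive w wf i j (inRow i j<sh)
    ; vanishes          = λ i j sh≤j → fill-outside w i j (subst (_≤ toℕ j) (sym (len≡ i)) sh≤j)
    ; shape≤n           = sh≤n
    ; shape-antitone    = λ i i' i<i' → subst₂ _≤_ (len≡ i') (len≡ i) (tailsInRegion⇒InRegion (steps w) reg i i' i<i')
    ; row-increasing    = λ i j j' j<j' j'<sh → fill-row-increasing w wf i j j' j<j' (inRow i j'<sh)
    ; column-increasing = λ i i' j i<i' j<sh → fill-column-increasing w wf reg i i' j i<i' (inRow i' j<sh)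
    ; bounded           = fill≤top w
    ; covers            = λ v 1≤v v≤top → let (i , j , j<len , fill≡v) = fill-covers w wf bd v 1≤v v≤top in
                            i , j , subst (toℕ j <_) (len≡ i) j<len , fill≡v }
    where
    inRow : ∀ i {c} → c < sh i → c < rowLength i w
    inRow i c<sh = subst (_ <_) (sym (len≡ i)) c<sh
    bd : Bounded w
    bd i = subst (_≤ n) (sym (len≡ i)) (sh≤n i)

  module _ {f sh V} (inc : IncFilling f sh V) where
    open IncFilling inc

    nonempty⇒1≤V : ∀ {N} → sumFin sh ≡ suc N → 1 ≤ V
    nonempty⇒1≤V size with sumFin-positive sh size
    ... | i , 1≤sh = ≤-trans (positive i j (subst (_< sh i) (sym (Fin.toℕ-fromℕ< 1≤n)) 1≤sh)) (bounded i j)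
      where
      1≤n = ≤-trans 1≤sh (shape≤n i)
      j   = fromℕ< 1≤n

    topmostLargest : 1 ≤ V →
      Σ (Fin m) λ i* → Σ (Fin n) (λ j* → f i* j* ≡ V) × (∀ i → toℕ i < toℕ i* → ¬ Σ (Fin n) (λ j → f i j ≡ V))
    topmostLargest 1≤V with covers V 1≤V ≤-refl
    ... | i , j , _ , fij≡V = leastWitness (λ i → Σ (Fin n) (λ j → f i j ≡ V)) (λ i → Fin.any? (λ j → f i j ≟ V)) i (j , fij≡V)

    largest⇒rowEnd : 1 ≤ V → ∀ i j → f i j ≡ V → sh i ≡ suc (toℕ j)
    largest⇒rowEnd 1≤V i j fij≡V =
      ≤-antisym (≮⇒≥ next∉shape) (positive⇒inShape vanishes i j (subst (1 ≤_) (sym fij≡V) 1≤V))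
      where
      next∉shape : ¬ suc (toℕ j) < sh i
      next∉shape j+1<sh = <⇒≱ (row-increasing i j j+1 (≤-reflexive (sym toℕ-j+1)) (subst (_< sh i) (sym toℕ-j+1) j+1<sh))
                               (subst (f i j+1 ≤_) (sym fij≡V) (bounded i j+1))
        where
        j+1 = fromℕ< (≤-trans j+1<sh (shape≤n i))
        toℕ-j+1 = Fin.toℕ-fromℕ< (≤-trans j+1<sh (shape≤n i))

  _≟-cell_ : (c c' : Fin m × Fin n) → Dec (c ≡ c')
  _≟-cell_ = ≡-dec Fin._≟_ Fin._≟_

  clearCell : (Fin m → Fin n → ℕ) → Fin m × Fin n → Fin m → Fin n → ℕ
  clearCell f c i j = if does (c ≟-cell (i , j)) then 0 else f i j

  clearCell-cell : ∀ f i j → clearCell f (i , j) i j ≡ 0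
  clearCell-cell f i j rewrite dec-true ((i , j) ≟-cell (i , j)) refl = refl

  clearCell-other : ∀ f c i j → ¬ c ≡ (i , j) → clearCell f c i j ≡ f i j
  clearCell-other f c i j c≢ rewrite dec-false (c ≟-cell (i , j)) c≢ = refl

  module RemoveLargest {f sh V} (inc : IncFilling f sh V) (1≤V : 1 ≤ V) (i* : Fin m) (j* : Fin n)
    (f*≡V : f i* j* ≡ V) (topmost : ∀ i → toℕ i < toℕ i* → ¬ Σ (Fin n) (λ j → f i j ≡ V)) where
    open IncFilling inc

    sh*≡ : sh i* ≡ suc (toℕ j*)
    sh*≡ = largest⇒rowEnd inc 1≤V i* j* f*≡V

    f' : Fin m → Fin n → ℕ
    f' = clearCell f (i* , j*)

    f'-other : ∀ i j → ¬ (i* , j*) ≡ (i , j) → f' i j ≡ f i j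
    f'-other = clearCell-other f (i* , j*)

    sh' : Fin m → ℕ
    sh' i = if does (i* Fin.≟ i) then toℕ j* else sh i

    sh'-here : sh' i* ≡ toℕ j*
    sh'-here rewrite dec-true (i* Fin.≟ i*) refl = refl

    sh'-there : ∀ i → ¬ i* ≡ i → sh' i ≡ sh i
    sh'-there i i*≢i rewrite dec-false (i* Fin.≟ i) i*≢i = refl

    sh'≤sh : ∀ i → sh' i ≤ sh i
    sh'≤sh i = by-row (i* Fin.≟ i)
      where
      by-row : Dec (i* ≡ i) → sh' i ≤ sh i
      by-row (yes refl) = subst₂ _≤_ (sym sh'-here) (sym sh*≡) (n≤1+n _)
      by-row (no i*≢i)  = ≤-reflexive (sh'-there i i*≢i)

    size-sh : sumFin sh ≡ suc (sumFin sh')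
    size-sh = sumFin-bump sh sh' i* (λ i i≢i* → sym (sh'-there i (λ e → i≢i* (sym e)))) (trans sh*≡ (cong suc (sym sh'-here)))

    f'≤f : ∀ i j → f' i j ≤ f i j
    f'≤f i j = by-cell ((i* , j*) ≟-cell (i , j))
      where
      by-cell : Dec ((i* , j*) ≡ (i , j)) → f' i j ≤ f i j
      by-cell (yes refl) = subst (_≤ f i j) (sym (clearCell-cell f i j)) z≤n
      by-cell (no c≢)    = ≤-reflexive (f'-other i j c≢)

    f'≡V⇒f≡V : ∀ i j → f' i j ≡ V → f i j ≡ V
    f'≡V⇒f≡V i j f'≡V = by-cell ((i* , j*) ≟-cell (i , j))
      where
      by-cell : Dec ((i* , j*) ≡ (i , j)) → f i j ≡ V
      by-cell (yes refl) = ⊥-elim (<⇒≢ 1≤V (trans (sym (clearCell-cell f i j)) f'≡V))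
      by-cell (no c≢)    = trans (sym (f'-other i j c≢)) f'≡V

    inShape'⇒notCleared : ∀ i j → toℕ j < sh' i → ¬ (i* , j*) ≡ (i , j)
    inShape'⇒notCleared i j j<sh' refl = <-irrefl refl (subst (toℕ j* <_) sh'-here j<sh')

    f'-inShape : ∀ i j → toℕ j < sh' i → f' i j ≡ f i j
    f'-inShape i j j<sh' = f'-other i j (inShape'⇒notCleared i j j<sh')

    sh'-antitone : ∀ (i i' : Fin m) → toℕ i < toℕ i' → sh' i' ≤ sh' i
    sh'-antitone i i' i<i' = by-rows (i* Fin.≟ i') (i* Fin.≟ i)
      where
      by-rows : Dec (i* ≡ i') → Dec (i* ≡ i) → sh' i' ≤ sh' i
      by-rows (yes refl) (yes refl) = ⊥-elim (<-irrefl refl i<i')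
      by-rows (yes refl) (no i*≢i)  = subst₂ _≤_ (sym sh'-here) (sym (sh'-there i i*≢i))
                                      (≤-trans (n≤1+n _) (subst (_≤ sh i) sh*≡ (shape-antitone i i* i<i')))
      by-rows (no i*≢i') (no i*≢i)  = subst₂ _≤_ (sym (sh'-there i' i*≢i')) (sym (sh'-there i i*≢i)) (shape-antitone i i' i<i')
      by-rows (no i*≢i') (yes refl) = subst₂ _≤_ (sym (sh'-there i' i*≢i')) (sym sh'-here) (≮⇒≥ j*∉row)
        where
        j*∉row : ¬ toℕ j* < sh i'
        j*∉row j*<sh = <⇒≱ (column-increasing i* i' j* i<i' j*<sh) (subst (f i' j* ≤_) (sym f*≡V) (bounded i' j*))

    vanishes' : ∀ i j → sh' i ≤ toℕ j → f' i j ≡ 0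
    vanishes' i j sh'≤j = by-cell ((i* , j*) ≟-cell (i , j))
      where
      sh≤j : ¬ (i* , j*) ≡ (i , j) → Dec (i* ≡ i) → sh i ≤ toℕ j
      sh≤j c≢ (no i*≢i) = subst (_≤ toℕ j) (sh'-there i i*≢i) sh'≤j
      sh≤j c≢ (yes refl) = subst (_≤ toℕ j) (sym sh*≡)
        (≤∧≢⇒< (subst (_≤ toℕ j) sh'-here sh'≤j) (λ e → c≢ (cong (i* ,_) (Fin.toℕ-injective e))))
      by-cell : Dec ((i* , j*) ≡ (i , j)) → f' i j ≡ 0
      by-cell (yes refl) = clearCell-cell f i j
      by-cell (no c≢)    = trans (f'-other i j c≢) (vanishes i j (sh≤j c≢ (i* Fin.≟ i)))

    coversBelow : ∀ v → 1 ≤ v → v < V → Σ (Fin m) λ i → Σ (Fin n) λ j → toℕ j < sh' i × f' i j ≡ v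
    coversBelow v 1≤v v<V with covers v 1≤v (<⇒≤ v<V)
    ... | i , j , _ , fij≡v = i , j , positive⇒inShape vanishes' i j (subst (1 ≤_) (sym f'≡v) 1≤v) , f'≡v
      where
      f'≡v = trans (f'-other i j λ { refl → <⇒≢ v<V (trans (sym fij≡v) f*≡V) }) fij≡v

    incFilling' : ∀ {V'} → (∀ i j → f' i j ≤ V') →
      (∀ v → 1 ≤ v → v ≤ V' → Σ (Fin m) λ i → Σ (Fin n) λ j → toℕ j < sh' i × f' i j ≡ v) → IncFilling f' sh' V'
    incFilling' bounded' covers' = record
      { positive          = λ i j j<sh' → subst (1 ≤_) (sym (f'-inShape i j j<sh')) (positive i j (≤-trans j<sh' (sh'≤sh i)))
      ; vanishes          = vanishes'
      ; shape≤n           = λ i → ≤-trans (sh'≤sh i) (shape≤n i)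
      ; shape-antitone    = sh'-antitone
      ; row-increasing    = λ i j j' j<j' j'<sh' →
          subst₂ _<_ (sym (f'-inShape i j (<-trans j<j' j'<sh'))) (sym (f'-inShape i j' j'<sh'))
                 (row-increasing i j j' j<j' (≤-trans j'<sh' (sh'≤sh i)))
      ; column-increasing = λ i i' j i<i' j<sh' →
          subst₂ _<_ (sym (f'-inShape i j (≤-trans j<sh' (sh'-antitone i i' i<i')))) (sym (f'-inShape i' j j<sh'))
                 (column-increasing i i' j i<i' (≤-trans j<sh' (sh'≤sh i')))
      ; bounded           = bounded'
      ; covers            = covers' }

    V-remains : (Σ (Fin m) λ i → Σ (Fin n) λ j → f' i j ≡ V) → IncFilling f' sh' V
    V-remains (i , j , f'≡V) = incFilling' (λ i j → ≤-trans (f'≤f i j) (bounded i j)) covers'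
      where
      covers' : ∀ v → 1 ≤ v → v ≤ V → Σ (Fin m) λ i → Σ (Fin n) λ j → toℕ j < sh' i × f' i j ≡ v
      covers' v 1≤v v≤V with v ≟ V
      ... | yes refl = i , j , positive⇒inShape vanishes' i j (subst (1 ≤_) (sym f'≡V) 1≤v) , f'≡V
      ... | no v≢V   = coversBelow v 1≤v (≤∧≢⇒< v≤V v≢V)

    V-disappears : ¬ (Σ (Fin m) λ i → Σ (Fin n) λ j → f' i j ≡ V) → IncFilling f' sh' (pred V)
    V-disappears V∉f' = incFilling'
      (λ i j → <⇒≤pred (≤∧≢⇒< (≤-trans (f'≤f i j) (bounded i j)) (λ e → V∉f' (i , j , e))))
      (λ v 1≤v v≤V-1 → coversBelow v 1≤v (≤-<-trans v≤V-1 (subst (pred V <_) (suc-pred V ⦃ >-nonZero 1≤V ⦄) ≤-refl)))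

    -- i* is the topmost row containing V, and within row i* the entry V sits only at j*.
    V-below : ∀ i j → f' i j ≡ V → toℕ i* < toℕ i
    V-below i j f'≡V = ≤∧≢⇒< (≮⇒≥ (λ i<i* → topmost i i<i* (j , fij≡V))) (λ e → i*≢i (Fin.toℕ-injective e))
      where
      fij≡V = f'≡V⇒f≡V i j f'≡V
      i*≢i : ¬ i* ≡ i
      i*≢i refl = <-irrefl (trans fij≡V (sym f*≡V)) (row-increasing i* j j* j<j* (subst (toℕ j* <_) (sym sh*≡) ≤-refl))
        where
        j≢j* : ¬ toℕ j ≡ toℕ j*
        j≢j* e with Fin.toℕ-injective e
        ... | refl = <⇒≢ 1≤V (trans (sym (clearCell-cell f i* j*)) f'≡V)
        j<j* : toℕ j < toℕ j*
        j<j* = ≤∧≢⇒< (s≤s⁻¹ (subst (toℕ j <_) sh*≡ (positive⇒inShape vanishes i* j (subst (1 ≤_) (sym fij≡V) 1≤V)))) j≢j*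

    module _ (w : FlaggedWord) (len : ∀ i → rowLength i w ≡ sh' i) where

      rowLength-extend : ∀ b i → rowLength i ((i* , b) ∷ w) ≡ sh i
      rowLength-extend b i with i* Fin.≟ i
      ... | yes refl = trans (cnt-here i* (steps w)) (trans (cong suc (trans (len i*) sh'-here)) (sym sh*≡))
      ... | no i*≢i  = trans (cnt-there i* i (steps w) i*≢i) (trans (len i) (sh'-there i i*≢i))

      inRegion-extend : ∀ b → T (tailsInRegion (steps w)) → T (tailsInRegion (steps ((i* , b) ∷ w)))
      inRegion-extend b reg = T-∧⁺ (InRegion⇒inRegion (i* ∷ steps w) (λ j j' j<j' →
        subst₂ _≤_ (sym (rowLength-extend b j')) (sym (rowLength-extend b j)) (shape-antitone j j' j<j'))) reg

      fill-extend : ∀ b → top ((i* , b) ∷ w) ≡ V → (∀ i j → fill w i j ≡ f' i j) → ∀ i j → fill ((i* , b) ∷ w) i j ≡ f i j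
      fill-extend b top≡ fill≡ i j with i* Fin.≟ i
      ... | no i*≢i = trans (fill-otherRow i* b w i j i*≢i) (trans (fill≡ i j) (f'-other i j (λ e → i*≢i (cong proj₁ e))))
      ... | yes refl with toℕ j ≟ rowLength i* w
      ...   | yes e = trans (fill-head i* b w j e) (trans top≡ (sym (subst (λ z → f i* z ≡ V) j*≡j f*≡V)))
        where j*≡j = Fin.toℕ-injective (trans (sym (trans (len i*) sh'-here)) (sym e))
      ...   | no j≢ = trans (fill-otherColumn i* b w i* j j≢) (trans (fill≡ i* j)
                        (f'-other i* j (λ e → j≢ (trans (cong (toℕ ∘ proj₂) (sym e)) (sym (trans (len i*) sh'-here))))))

      wellFlagged-extend : WellFlagged w → top w ≡ V → (∀ i j → fill w i j ≡ f' i j) → WellFlagged ((i* , true) ∷ w)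
      wellFlagged-extend wf top≡ fill≡ = next-below w wf top≡ fill≡ bd
        where
        bd : Bounded w
        bd i = subst (_≤ n) (sym (len i)) (≤-trans (sh'≤sh i) (shape≤n i))
        next-below : ∀ w → WellFlagged w → top w ≡ V → (∀ i j → fill w i j ≡ f' i j) → Bounded w → WellFlagged ((i* , true) ∷ w)
        next-below [] _ top≡ _ _ = ⊥-elim (<⇒≢ 1≤V top≡)
        next-below ((r , b) ∷ w) wf top≡ fill≡ bd with headCell r b w bd
        ... | j , j≡ = V-below r j (trans (sym (fill≡ r j)) (trans (fill-head r b w j j≡) top≡)) , wf

    extend : (b : Bool) {V' : ℕ} → top ((i* , b) ∷ []) + V' ≡ V → Decomposition f' sh' V' → Decomposition f sh V
    extend true  refl (decomposition w reg wf len top≡ fill≡) =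
      decomposition ((i* , true) ∷ w) (inRegion-extend w len true reg) (wellFlagged-extend w len wf top≡ fill≡)
        (rowLength-extend w len true) top≡ (fill-extend w len true top≡ fill≡)
    extend false refl (decomposition w reg wf len top≡ fill≡) =
      decomposition ((i* , false) ∷ w) (inRegion-extend w len false reg) wf
        (rowLength-extend w len false) (cong suc top≡) (fill-extend w len false (cong suc top≡) fill≡)

  decompose : ∀ N {f sh V} → sumFin sh ≡ N → IncFilling f sh V → Decomposition f sh V
  decompose zero {f} {sh} {zero} size inc =
    decomposition [] tt tt (λ i → sym (empty i)) refl
      (λ i j → sym (IncFilling.vanishes inc i j (subst (_≤ toℕ j) (sym (empty i)) z≤n)))
    where empty = sumFin≡0⇒≡0 sh size
  decompose zero {f} {sh} {suc V} size inc with IncFilling.covers inc 1 (s≤s z≤n) (s≤s z≤n)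
  ... | i , j , j<sh , _ = ⊥-elim (<⇒≱ j<sh (subst (_≤ toℕ j) (sym (sumFin≡0⇒≡0 sh size i)) z≤n))
  decompose (suc N) {f} {sh} {V} size inc with topmostLargest inc (nonempty⇒1≤V inc size)
  ... | i* , (j* , f*≡V) , topmost = step (Fin.any? (λ i → Fin.any? (λ j → f' i j ≟ V)))
    where
    1≤V = nonempty⇒1≤V inc size
    open RemoveLargest inc 1≤V i* j* f*≡V topmost
    size' : sumFin sh' ≡ N
    size' = suc-injective (trans (sym size-sh) size)
    step : Dec (Σ (Fin m) λ i → Σ (Fin n) λ j → f' i j ≡ V) → Decomposition f sh V
    step (yes V∈f') = extend true  refl (decompose N size' (V-remains V∈f'))
    step (no  V∉f') = extend false (suc-pred V ⦃ >-nonZero 1≤V ⦄) (decompose N size' (V-disappears V∉f'))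

  SameFill : FlaggedWord → FlaggedWord → Set
  SameFill w₁ w₂ = ∀ i j → fill w₁ i j ≡ fill w₂ i j

  rowLength-unique : ∀ w₁ w₂ → WellFlagged w₁ → WellFlagged w₂ → Bounded w₁ → Bounded w₂ → SameFill w₁ w₂ →
    ∀ i → rowLength i w₁ ≡ rowLength i w₂
  rowLength-unique w₁ w₂ wf₁ wf₂ bd₁ bd₂ same i with <-cmp (rowLength i w₁) (rowLength i w₂)
  ... | tri≈ _ e _  = e
  ... | tri< l<l' _ _ = ⊥-elim (shorter w₁ w₂ wf₂ bd₂ same l<l')
    where
    shorter : ∀ w₁ w₂ → WellFlagged w₂ → Bounded w₂ → SameFill w₁ w₂ → ¬ rowLength i w₁ < rowLength i w₂
    shorter w₁ w₂ wf₂ bd₂ same l<l' = <⇒≢ (fill-positive w₂ wf₂ i j (subst (_< rowLength i w₂) (sym toℕ-j) l<l'))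
                                          (sym (trans (sym (same i j)) (fill-outside w₁ i j (≤-reflexive (sym toℕ-j)))))
      where
      j = fromℕ< (≤-trans l<l' (bd₂ i))
      toℕ-j = Fin.toℕ-fromℕ< (≤-trans l<l' (bd₂ i))
  ... | tri> _ _ l'<l = ⊥-elim (<⇒≢ (fill-positive w₁ wf₁ i j (subst (_< rowLength i w₁) (sym toℕ-j) l'<l))
                                    (sym (trans (same i j) (fill-outside w₂ i j (≤-reflexive (sym toℕ-j))))))
    where
    j = fromℕ< (≤-trans l'<l (bd₁ i))
    toℕ-j = Fin.toℕ-fromℕ< (≤-trans l'<l (bd₁ i))

  top≤top : ∀ r b w w' → Bounded ((r , b) ∷ w) → SameFill ((r , b) ∷ w) w' → top ((r , b) ∷ w) ≤ top w'
  top≤top r b w w' bd same with headCell r b w bd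
  ... | j , j≡ = subst (_≤ top w') (trans (sym (same r j)) (fill-head r b w j j≡)) (fill≤top w' r j)

  top-unique : ∀ r₁ b₁ w₁ r₂ b₂ w₂ → Bounded ((r₁ , b₁) ∷ w₁) → Bounded ((r₂ , b₂) ∷ w₂) →
    SameFill ((r₁ , b₁) ∷ w₁) ((r₂ , b₂) ∷ w₂) → top ((r₁ , b₁) ∷ w₁) ≡ top ((r₂ , b₂) ∷ w₂)
  top-unique r₁ b₁ w₁ r₂ b₂ w₂ bd₁ bd₂ same =
    ≤-antisym (top≤top r₁ b₁ w₁ ((r₂ , b₂) ∷ w₂) bd₁ same) (top≤top r₂ b₂ w₂ ((r₁ , b₁) ∷ w₁) bd₂ (λ i j → sym (same i j)))

  head-unique : ∀ r₁ b₁ w₁ r₂ b₂ w₂ → WellFlagged ((r₁ , b₁) ∷ w₁) → Bounded ((r₂ , b₂) ∷ w₂) →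
    top ((r₁ , b₁) ∷ w₁) ≡ top ((r₂ , b₂) ∷ w₂) → SameFill ((r₁ , b₁) ∷ w₁) ((r₂ , b₂) ∷ w₂) → toℕ r₁ ≤ toℕ r₂
  head-unique r₁ b₁ w₁ r₂ b₂ w₂ wf₁ bd₂ top≡ same with headCell r₂ b₂ w₂ bd₂
  ... | j , j≡ = fill≡top⇒head≤row r₁ b₁ w₁ r₂ j wf₁ (trans (same r₂ j) (trans (fill-head r₂ b₂ w₂ j j≡) (sym top≡)))

  -- The head of a set flag repeats the top entry in a lower row, where the other word has only smaller entries.
  flag-unique : ∀ r w₁ w₂ → WellFlagged ((r , true) ∷ w₁) → Bounded ((r , true) ∷ w₁) →
    top ((r , true) ∷ w₁) ≡ top ((r , false) ∷ w₂) → ¬ SameFill ((r , true) ∷ w₁) ((r , false) ∷ w₂)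
  flag-unique r ((r' , b') ∷ w₁) w₂ (r<r' , _) bd top≡ same with headCell r' b' w₁ (bounded-tail (r , true) ((r' , b') ∷ w₁) bd)
  ... | j , j≡ = <-irrefl refl (subst (_< top ((r , false) ∷ w₂)) fill₂≡top (s≤s (fill≤top w₂ r' j)))
    where
    r≢r' : ¬ r ≡ r'
    r≢r' e = <-irrefl (cong toℕ e) r<r'
    fill₂≡top : fill w₂ r' j ≡ top ((r , false) ∷ w₂)
    fill₂≡top = begin
      fill w₂ r' j                            ≡⟨ fill-otherRow r false w₂ r' j r≢r' ⟨
      fill ((r , false) ∷ w₂) r' j           ≡⟨ same r' j ⟨
      fill ((r , true) ∷ (r' , b') ∷ w₁) r' j ≡⟨ fill-otherRow r true ((r' , b') ∷ w₁) r' j r≢r' ⟩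
      fill ((r' , b') ∷ w₁) r' j             ≡⟨ fill-head r' b' w₁ j j≡ ⟩
      top ((r' , b') ∷ w₁)                   ≡⟨ top≡ ⟩
      top ((r , false) ∷ w₂)                 ∎
      where open ≡-Reasoning

  SameFill-tail : ∀ r b₁ b₂ w₁ w₂ → rowLength r w₁ ≡ rowLength r w₂ →
    SameFill ((r , b₁) ∷ w₁) ((r , b₂) ∷ w₂) → SameFill w₁ w₂
  SameFill-tail r b₁ b₂ w₁ w₂ len≡ same i j with r Fin.≟ i
  ... | no r≢i = trans (sym (fill-otherRow r b₁ w₁ i j r≢i)) (trans (same i j) (fill-otherRow r b₂ w₂ i j r≢i))
  ... | yes refl with toℕ j ≟ rowLength r w₁
  ...   | yes e  = trans (fill-outside w₁ r j (≤-reflexive (sym e)))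
                         (sym (fill-outside w₂ r j (≤-reflexive (sym (trans e len≡)))))
  ...   | no j≢  = trans (sym (fill-otherColumn r b₁ w₁ r j j≢))
                     (trans (same r j) (fill-otherColumn r b₂ w₂ r j (λ e → j≢ (trans e (sym len≡)))))

  fill-injective : ∀ w₁ w₂ → WellFlagged w₁ → WellFlagged w₂ → Bounded w₁ → Bounded w₂ → SameFill w₁ w₂ → w₁ ≡ w₂
  fill-injective [] [] _ _ _ _ _ = refl
  fill-injective [] ((r , b) ∷ w) wf₁ wf₂ bd₁ bd₂ same =
    ⊥-elim (0≢1+n (trans (rowLength-unique [] ((r , b) ∷ w) wf₁ wf₂ bd₁ bd₂ same r) (cnt-here r (steps w))))
  fill-injective ((r , b) ∷ w) [] wf₁ wf₂ bd₁ bd₂ same =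
    ⊥-elim (0≢1+n (trans (sym (rowLength-unique ((r , b) ∷ w) [] wf₁ wf₂ bd₁ bd₂ same r)) (cnt-here r (steps w))))
  fill-injective ((r₁ , b₁) ∷ w₁) ((r₂ , b₂) ∷ w₂) wf₁ wf₂ bd₁ bd₂ same
    with Fin.toℕ-injective (≤-antisym (head-unique r₁ b₁ w₁ r₂ b₂ w₂ wf₁ bd₂ top≡ same)
                                      (head-unique r₂ b₂ w₂ r₁ b₁ w₁ wf₂ bd₁ (sym top≡) (λ i j → sym (same i j))))
    where top≡ = top-unique r₁ b₁ w₁ r₂ b₂ w₂ bd₁ bd₂ same
  ... | refl = cong₂ (λ b w → (r₁ , b) ∷ w) (flags≡ b₁ b₂ wf₁ wf₂ bd₁ bd₂ (top-unique r₁ b₁ w₁ r₁ b₂ w₂ bd₁ bd₂ same) same) tails≡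
    where
    r = r₁
    flags≡ : ∀ b₁ b₂ → WellFlagged ((r , b₁) ∷ w₁) → WellFlagged ((r , b₂) ∷ w₂) →
      Bounded ((r , b₁) ∷ w₁) → Bounded ((r , b₂) ∷ w₂) →
      top ((r , b₁) ∷ w₁) ≡ top ((r , b₂) ∷ w₂) → SameFill ((r , b₁) ∷ w₁) ((r , b₂) ∷ w₂) → b₁ ≡ b₂
    flags≡ true  true  _   _   _   _   _    _    = refl
    flags≡ false false _   _   _   _   _    _    = refl
    flags≡ true  false wf₁ _   bd₁ _   top≡ same = ⊥-elim (flag-unique r w₁ w₂ wf₁ bd₁ top≡ same)
    flags≡ false true  _   wf₂ _   bd₂ top≡ same = ⊥-elim (flag-unique r w₂ w₁ wf₂ bd₂ (sym top≡) (λ i j → sym (same i j)))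
    len≡ : rowLength r w₁ ≡ rowLength r w₂
    len≡ = suc-injective (trans (sym (cnt-here r (steps w₁)))
             (trans (rowLength-unique ((r , b₁) ∷ w₁) ((r , b₂) ∷ w₂) wf₁ wf₂ bd₁ bd₂ same r) (cnt-here r (steps w₂))))
    tails≡ : w₁ ≡ w₂
    tails≡ = fill-injective w₁ w₂ (wellFlagged-tail (r , b₁) w₁ wf₁) (wellFlagged-tail (r , b₂) w₂ wf₂)
               (bounded-tail (r , b₁) w₁ bd₁) (bounded-tail (r , b₂) w₂ bd₂) (SameFill-tail r b₁ b₂ w₁ w₂ len≡ same)


  bit : Bool → ℕ
  bit c = if c then 1 else 0

  ascentsᴿ : List (Fin m) → ℕ
  ascentsᴿ [] = 0
  ascentsᴿ (x ∷ []) = 0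
  ascentsᴿ (x ∷ y ∷ u) = bit (toℕ x <ᵇ toℕ y) + ascentsᴿ (y ∷ u)

  flagOf : ∀ {k} (c : Bool) → Vec Bool (bit c + k) → Bool
  flagOf true (b ∷ _) = b
  flagOf false _ = false

  restOf : ∀ {k} (c : Bool) → Vec Bool (bit c + k) → Vec Bool k
  restOf true (_ ∷ v) = v
  restOf false v = v

  pack : ∀ {k} (c : Bool) → Bool → Vec Bool k → Vec Bool (bit c + k)
  pack true b v = b ∷ v
  pack false b v = v

  pack-flag-rest : ∀ {k} c (marks : Vec Bool (bit c + k)) → pack c (flagOf c marks) (restOf c marks) ≡ marks
  pack-flag-rest true (b ∷ v) = refl
  pack-flag-rest false v = refl

  -- The mark of an ascent x < y (newest first) becomes the flag of x; other steps get no flag.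
  mutual
    attachFlags : (u : List (Fin m)) → Vec Bool (ascentsᴿ u) → FlaggedWord
    attachFlags [] _ = []
    attachFlags (x ∷ u) marks = (x , headFlag x u marks) ∷ attachTail x u marks

    headFlag : (x : Fin m) (u : List (Fin m)) → Vec Bool (ascentsᴿ (x ∷ u)) → Bool
    headFlag x [] _ = false
    headFlag x (y ∷ u) marks = flagOf (toℕ x <ᵇ toℕ y) marks

    attachTail : (x : Fin m) (u : List (Fin m)) → Vec Bool (ascentsᴿ (x ∷ u)) → FlaggedWord
    attachTail x [] _ = []
    attachTail x (y ∷ u) marks = attachFlags (y ∷ u) (restOf (toℕ x <ᵇ toℕ y) marks)

  flagsFrom : ∀ x b w → WellFlagged ((x , b) ∷ w) → Vec Bool (ascentsᴿ (x ∷ steps w))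
  flagsFrom x b [] _ = []
  flagsFrom x b ((y , b') ∷ w) wf = pack (toℕ x <ᵇ toℕ y) b (flagsFrom y b' w (wellFlagged-tail (x , b) _ wf))

  flagsOf : (w : FlaggedWord) → WellFlagged w → Vec Bool (ascentsᴿ (steps w))
  flagsOf [] _ = []
  flagsOf ((x , b) ∷ w) wf = flagsFrom x b w wf

  attachFlags-wellFlagged : ∀ u marks → WellFlagged (attachFlags u marks)
  attachFlags-wellFlagged [] _ = tt
  attachFlags-wellFlagged (x ∷ []) _ = tt
  attachFlags-wellFlagged (x ∷ y ∷ u) marks =
    flag-ok (toℕ x <ᵇ toℕ y) (λ e → <ᵇ⇒< _ _ (subst T (sym e) tt)) marks (attachFlags-wellFlagged (y ∷ u))
    where
    flag-ok : ∀ c → (c ≡ true → toℕ x < toℕ y) → (marks : Vec Bool (bit c + ascentsᴿ (y ∷ u))) →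
      (∀ marks' → WellFlagged (attachFlags (y ∷ u) marks')) →
      WellFlagged ((x , flagOf c marks) ∷ attachFlags (y ∷ u) (restOf c marks))
    flag-ok true x<y⇒ (true ∷ marks) wf-tail = x<y⇒ refl , wf-tail marks
    flag-ok true x<y⇒ (false ∷ marks) wf-tail = wf-tail marks
    flag-ok false x<y⇒ marks wf-tail = wf-tail marks

  Marked : Set
  Marked = Σ (List (Fin m)) (λ u → Vec Bool (ascentsᴿ u))

  consMarked : Fin m → Bool → Marked → Marked
  consMarked x b ([] , marks) = (x ∷ [] , [])
  consMarked x b ((y ∷ v) , marks) = (x ∷ y ∷ v , pack (toℕ x <ᵇ toℕ y) b marks)

  flagsOf-attachFlags : ∀ u marks wf →
    _≡_ {A = Marked} (steps (attachFlags u marks) , flagsOf (attachFlags u marks) wf) (u , marks)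
  flagsOf-attachFlags [] [] wf = refl
  flagsOf-attachFlags (x ∷ []) [] wf = refl
  flagsOf-attachFlags (x ∷ y ∷ u) marks wf =
    trans (cong (consMarked x (flagOf c marks))
                (flagsOf-attachFlags (y ∷ u) (restOf c marks) (wellFlagged-tail (x , flagOf c marks) _ wf)))
          (cong (λ z → (x ∷ y ∷ u , z)) (pack-flag-rest c marks))
    where c = toℕ x <ᵇ toℕ y

  unattach : ∀ {w u marks} → w ≡ attachFlags u marks → (wf : WellFlagged w) →
    _≡_ {A = Marked} (steps w , flagsOf w wf) (u , marks)
  unattach {u = u} {marks} refl wf = flagsOf-attachFlags u marks wf

  steps-attachFlags : ∀ u marks → steps (attachFlags u marks) ≡ u
  steps-attachFlags u marks = cong proj₁ (flagsOf-attachFlags u marks (attachFlags-wellFlagged u marks))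

  attachFlags-flagsOf : ∀ w wf → attachFlags (steps w) (flagsOf w wf) ≡ w
  attachFlags-flagsOf [] wf = refl
  attachFlags-flagsOf ((x , b) ∷ w) wf = go x b w wf
    where
    go : ∀ x b w wf → attachFlags (x ∷ steps w) (flagsFrom x b w wf) ≡ (x , b) ∷ w
    go x false [] wf = refl
    go x true [] ()
    go x b ((y , b') ∷ w) wf with toℕ x <ᵇ toℕ y in x≮y
    ... | true = cong ((x , b) ∷_) (go y b' w (wellFlagged-tail (x , b) ((y , b') ∷ w) wf))
    go x false ((y , b') ∷ w) wf | false = cong ((x , false) ∷_) (go y b' w wf)
    go x true ((y , b') ∷ w) (x<y , _) | false = ⊥-elim (subst T x≮y (<⇒<ᵇ x<y))

module Rectangle (a b : ℕ) where

  m n : ℕ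
  m = suc a
  n = suc b

  open Tableaux m n

  full : Fin m → ℕ
  full _ = n

  table : (Fin m → Fin n → ℕ) → Vec (Vec ℕ n) m
  table f = tabulate (λ i → tabulate (f i))

  entry-table : ∀ f i j → entry (table f) i j ≡ f i j
  entry-table f i j = trans (cong (λ row → lookup row j) (Vec.lookup∘tabulate (λ i → tabulate (f i)) i))
                            (Vec.lookup∘tabulate (f i) j)

  table-entry : ∀ (t : Vec (Vec ℕ n) m) f → (∀ i j → f i j ≡ entry t i j) → table f ≡ t
  table-entry t f f≡ = trans (Vec.tabulate-cong (λ i → trans (Vec.tabulate-cong (f≡ i)) (Vec.tabulate∘lookup (lookup t i))))
                             (Vec.tabulate∘lookup t)

  module _ (k : ℕ) (t : Vec (Vec ℕ n) m) where
    private
      positiveAt : Fin m → Fin n → Bool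
      positiveAt i j = 0 <ᵇ entry t i j
      rowAt : Fin m → Fin n → Fin n → Bool
      rowAt i j j' = (toℕ j <ᵇ toℕ j') ⇒ᵇ (entry t i j <ᵇ entry t i j')
      columnAt : Fin m → Fin m → Fin n → Bool
      columnAt i i' j = (toℕ i <ᵇ toℕ i') ⇒ᵇ (entry t i j <ᵇ entry t i' j)
      boundedAt : Fin m → Fin n → Bool
      boundedAt i j = entry t i j ≤ᵇ (m * n ∸ k)
      coveredAt : ℕ → Bool
      coveredAt v = anyFin m (λ i → anyFin n (λ j → entry t i j ≡ᵇ suc v))
      positiveᵇ rowsᵇ columnsᵇ boundedᵇ : Bool
      positiveᵇ = allFin m (λ i → allFin n (positiveAt i))
      rowsᵇ     = allFin m (λ i → allFin n (λ j → allFin n (rowAt i j)))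
      columnsᵇ  = allFin m (λ i → allFin m (λ i' → allFin n (columnAt i i')))
      boundedᵇ  = allFin m (λ i → allFin n (boundedAt i))

    isInc⇒IncFilling : T (isInc m n k t) → IncFilling (entry t) full (m * n ∸ k)
    isInc⇒IncFilling inc = record
      { positive          = λ i j _ → <ᵇ⇒< _ _ (allFin²-elim m n positiveAt pos i j)
      ; vanishes          = λ i j n≤j → ⊥-elim (<⇒≱ (Fin.toℕ<n j) n≤j)
      ; shape≤n           = λ _ → ≤-refl
      ; shape-antitone    = λ _ _ _ → ≤-refl
      ; row-increasing    = λ i j j' j<j' _ → <ᵇ⇒< _ _ (⇒ᵇ-elim (row-ok i j j') (<⇒<ᵇ j<j'))
      ; column-increasing = λ i i' j i<i' _ → <ᵇ⇒< _ _ (⇒ᵇ-elim (column-ok i i' j) (<⇒<ᵇ i<i'))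
      ; bounded           = λ i j → ≤ᵇ⇒≤ _ _ (allFin²-elim m n boundedAt bnd i j)
      ; covers            = covers }
      where
      pos  = proj₁ (T-∧⁻ {positiveᵇ} inc)
      inc₁ = proj₂ (T-∧⁻ {positiveᵇ} inc)
      rows = proj₁ (T-∧⁻ {rowsᵇ} inc₁)
      inc₂ = proj₂ (T-∧⁻ {rowsᵇ} inc₁)
      cols = proj₁ (T-∧⁻ {columnsᵇ} inc₂)
      inc₃ = proj₂ (T-∧⁻ {columnsᵇ} inc₂)
      bnd  = proj₁ (T-∧⁻ {boundedᵇ} inc₃)
      cov  = proj₂ (T-∧⁻ {boundedᵇ} inc₃)
      row-ok : ∀ i j j' → T (rowAt i j j')
      row-ok i j = allFin-elim n (rowAt i j) (allFin²-elim m n (λ i j → allFin n (rowAt i j)) rows i j)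
      column-ok : ∀ i i' j → T (columnAt i i' j)
      column-ok i i' = allFin-elim n (columnAt i i') (allFin²-elim m m (λ i i' → allFin n (columnAt i i')) cols i i')
      covers : ∀ v → 1 ≤ v → v ≤ m * n ∸ k → Σ (Fin m) λ i → Σ (Fin n) λ j → toℕ j < n × entry t i j ≡ v
      covers (suc v) _ v<V with anyFin-elim m _ (allBelow-elim (m * n ∸ k) coveredAt cov v v<V)
      ... | i , covᵢ with anyFin-elim n _ covᵢ
      ...   | j , covᵢⱼ = i , j , Fin.toℕ<n j , ≡ᵇ⇒≡ _ _ covᵢⱼ

    IncFilling⇒isInc : ∀ {f sh V} → (∀ i j → entry t i j ≡ f i j) → (∀ i → sh i ≡ n) → V ≡ m * n ∸ k →
      IncFilling f sh V → T (isInc m n k t)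
    IncFilling⇒isInc {f} {sh} t≡f sh≡n refl inc = T-∧⁺ pos (T-∧⁺ rows (T-∧⁺ cols (T-∧⁺ bnd cov)))
      where
      open IncFilling inc
      inShape : ∀ i j → toℕ j < sh i
      inShape i j = subst (toℕ j <_) (sym (sh≡n i)) (Fin.toℕ<n j)
      pos : T positiveᵇ
      pos = allFin²-intro m n positiveAt (λ i j → <⇒<ᵇ (subst (1 ≤_) (sym (t≡f i j)) (positive i j (inShape i j))))
      rows : T rowsᵇ
      rows = allFin²-intro m n (λ i j → allFin n (rowAt i j)) (λ i j → allFin-intro n (rowAt i j) (λ j' →
               ⇒ᵇ-intro (λ j<j' → <⇒<ᵇ (subst₂ _<_ (sym (t≡f i j)) (sym (t≡f i j'))
                                                   (row-increasing i j j' (<ᵇ⇒< _ _ j<j') (inShape i j'))))))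
      cols : T columnsᵇ
      cols = allFin²-intro m m (λ i i' → allFin n (columnAt i i')) (λ i i' → allFin-intro n (columnAt i i') (λ j →
               ⇒ᵇ-intro (λ i<i' → <⇒<ᵇ (subst₂ _<_ (sym (t≡f i j)) (sym (t≡f i' j))
                                                   (column-increasing i i' j (<ᵇ⇒< _ _ i<i') (inShape i' j))))))
      bnd : T boundedᵇ
      bnd = allFin²-intro m n boundedAt (λ i j → ≤⇒≤ᵇ (subst (_≤ _) (sym (t≡f i j)) (bounded i j)))
      cov : T (allBelow (m * n ∸ k) coveredAt)
      cov = allBelow-intro (m * n ∸ k) coveredAt (λ v v<V → let (i , j , _ , fij≡) = covers (suc v) (s≤s z≤n) v<V in
              anyFin-intro m (λ i → anyFin n (λ j → entry t i j ≡ᵇ suc v)) i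
                (anyFin-intro n (λ j → entry t i j ≡ᵇ suc v) j (≡⇒≡ᵇ _ _ (trans (t≡f i j) fij≡))))

  IncFilling-full-lowerBound : ∀ {f V} → IncFilling f full V →
    ∀ p q (p<m : p < m) (q<n : q < n) → p + q + 1 ≤ f (fromℕ< p<m) (fromℕ< q<n)
  IncFilling-full-lowerBound inc zero zero p<m q<n = IncFilling.positive inc _ _ (subst (_< n) (sym (Fin.toℕ-fromℕ< q<n)) q<n)
  IncFilling-full-lowerBound {f} inc p (suc q) p<m q+1<n =
    subst (_≤ f (fromℕ< p<m) (fromℕ< q+1<n)) (cong (_+ 1) (sym (+-suc p q)))
      (≤-trans (s≤s (IncFilling-full-lowerBound inc p q p<m q<n))
               (IncFilling.row-increasing inc _ _ _ (subst₂ _<_ (sym (Fin.toℕ-fromℕ< q<n)) (sym (Fin.toℕ-fromℕ< q+1<n)) ≤-refl)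
                                                    (subst (_< n) (sym (Fin.toℕ-fromℕ< q+1<n)) q+1<n)))
    where q<n = <-trans ≤-refl q+1<n
  IncFilling-full-lowerBound inc (suc p) zero p+1<m q<n =
    ≤-trans (s≤s (IncFilling-full-lowerBound inc p zero p<m q<n))
            (IncFilling.column-increasing inc _ _ _ (subst₂ _<_ (sym (Fin.toℕ-fromℕ< p<m)) (sym (Fin.toℕ-fromℕ< p+1<m)) ≤-refl)
                                                    (subst (_< n) (sym (Fin.toℕ-fromℕ< q<n)) q<n))
    where p<m = <-trans ≤-refl p+1<m

  IncFilling-full-top : ∀ {f V} → IncFilling f full V → a + b + 1 ≤ V
  IncFilling-full-top inc = ≤-trans (IncFilling-full-lowerBound inc a b ≤-refl ≤-refl) (IncFilling.bounded inc _ _)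

  suc*suc : ∀ x y → suc x * suc y ≡ x * y + (x + y + 1)
  suc*suc = solve-∀

  IsPathᴿ : List (Fin m) → Set
  IsPathᴿ u = T (tailsInRegion u) × T (allFin m (λ j → cnt j u ≡ᵇ n)) × length u ≡ m * n

  IsPathᴿ-irrelevant : ∀ u (p q : IsPathᴿ u) → p ≡ q
  IsPathᴿ-irrelevant u (p₁ , p₂ , p₃) (q₁ , q₂ , q₃) =
    cong₂ _,_ (T-irrelevant p₁ q₁) (cong₂ _,_ (T-irrelevant p₂ q₂) (≡-irrelevant p₃ q₃))

  MarkedPath : Set
  MarkedPath = Σ (List (Fin m)) (λ u → IsPathᴿ u × Vec Bool (ascentsᴿ u))

  MarkedPath-≡ : ∀ {u₁ u₂} {p₁ : IsPathᴿ u₁} {p₂ : IsPathᴿ u₂} {marks₁ marks₂} →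
    _≡_ {A = Marked} (u₁ , marks₁) (u₂ , marks₂) → _≡_ {A = MarkedPath} (u₁ , p₁ , marks₁) (u₂ , p₂ , marks₂)
  MarkedPath-≡ {u₁} {p₁ = p₁} {p₂} refl = cong (λ p → u₁ , p , _) (IsPathᴿ-irrelevant u₁ p₁ p₂)

  wordOf : MarkedPath → FlaggedWord
  wordOf (u , _ , marks) = attachFlags u marks

  wordOf-flags : ∀ x → WellFlagged (wordOf x)
  wordOf-flags (u , _ , marks) = attachFlags-wellFlagged u marks

  wordOf-inRegion : ∀ x → T (tailsInRegion (steps (wordOf x)))
  wordOf-inRegion (u , (reg , _) , marks) = subst (T ∘ tailsInRegion) (sym (steps-attachFlags u marks)) reg

  wordOf-rowLength : ∀ x i → rowLength i (wordOf x) ≡ n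
  wordOf-rowLength (u , (_ , full-u , _) , marks) i =
    trans (cong (cnt i) (steps-attachFlags u marks)) (≡ᵇ⇒≡ _ _ (allFin-elim m (λ j → cnt j u ≡ᵇ n) full-u i))

  wordOf-bounded : ∀ x → Bounded (wordOf x)
  wordOf-bounded x i = ≤-reflexive (wordOf-rowLength x i)

  wordOf-incFilling : ∀ x → IncFilling (fill (wordOf x)) full (top (wordOf x))
  wordOf-incFilling x = fill-incFilling (wordOf x) (wordOf-flags x) (wordOf-inRegion x) (wordOf-rowLength x) (λ _ → ≤-refl)

  top≤length : ∀ w → top w ≤ length (steps w)
  top≤length []               = z≤n
  top≤length ((_ , true) ∷ w)  = m≤n⇒m≤1+n (top≤length w)
  top≤length ((_ , false) ∷ w) = s≤s (top≤length w)

  wordOf-top≤ : ∀ x → top (wordOf x) ≤ m * n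
  wordOf-top≤ (u , (_ , _ , length≡) , marks) =
    subst (top (attachFlags u marks) ≤_) (trans (cong length (steps-attachFlags u marks)) length≡)
          (top≤length (attachFlags u marks))

  length≡sumFin-cnt : ∀ (u : List (Fin m)) → length u ≡ sumFin (λ i → cnt i u)
  length≡sumFin-cnt []      = sym (trans (sumFin-const m 0) (*-zeroʳ m))
  length≡sumFin-cnt (x ∷ u) = trans (cong suc (length≡sumFin-cnt u))
    (sym (trans (sumFin-+ (λ i → if toℕ x ≡ᵇ toℕ i then 1 else 0) (λ i → cnt i u))
                (cong (_+ sumFin (λ i → cnt i u)) (sumFin-indicator x))))

  -- This is also the number of set marks: the k of Inc_k.
  missing : MarkedPath → ℕ
  missing x = m * n ∸ top (wordOf x)

  missing≤ : ∀ x → missing x ≤ a * b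
  missing≤ x = subst (missing x ≤_) (trans (cong (_∸ (a + b + 1)) (suc*suc a b)) (m+n∸n≡m (a * b) (a + b + 1)))
                 (∸-monoʳ-≤ (m * n) (IncFilling-full-top (wordOf-incFilling x)))

  module IncBijection (k : ℕ) where

    k≤mn : ∀ t → T (isInc m n k t) → k ≤ m * n
    k≤mn t inc = <⇒≤ (m∸n≢0⇒n<m (λ e → <⇒≢ (nonempty⇒1≤V (isInc⇒IncFilling k t inc) refl) (sym e)))

    -- Opaque, so that checking the inverse laws below never unfolds the decomposition.
    opaque
      decomposeInc : ∀ t → T (isInc m n k t) → Decomposition (entry t) full (m * n ∸ k)
      decomposeInc t inc = decompose (sumFin full) refl (isInc⇒IncFilling k t inc)

    toMarked : ∀ t → k ≤ m * n → Decomposition (entry t) full (m * n ∸ k) → Fibre missing k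
    toMarked t k≤ (decomposition w reg wf len top≡ _) =
      (steps w , (reg , allFin-intro m _ (λ j → ≡⇒≡ᵇ _ _ (len j)) ,
                  trans (length≡sumFin-cnt (steps w)) (trans (sumFin-cong len) (sumFin-const m n))) , flagsOf w wf) ,
      trans (cong (λ w → m * n ∸ top w) (attachFlags-flagsOf w wf)) (trans (cong (m * n ∸_) top≡) (m∸[m∸n]≡n k≤))

    incTo : Inc m n k → Fibre missing k
    incTo (t , inc) = toMarked t (k≤mn t inc) (decomposeInc t inc)

    incFrom : Fibre missing k → Inc m n k
    incFrom (x , missing≡k) = table (fill (wordOf x)) ,
      IncFilling⇒isInc k (table (fill (wordOf x))) (entry-table (fill (wordOf x))) (λ _ → refl) top≡ (wordOf-incFilling x)
      where top≡ = sym (trans (cong (m * n ∸_) (sym missing≡k)) (m∸[m∸n]≡n (wordOf-top≤ x)))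

    toMarked-fill : ∀ x e d k≤ → toMarked (table (fill (wordOf x))) k≤ d ≡ (x , e)
    toMarked-fill x@(u , _ , marks) e (decomposition w _ wf len _ fill≡) k≤ =
      Fibre-≡ (MarkedPath-≡ (unattach w≡ wf))
      where
      w≡ : w ≡ attachFlags u marks
      w≡ = fill-injective w (attachFlags u marks) wf (wordOf-flags x) (λ i → ≤-reflexive (len i)) (wordOf-bounded x)
             (λ i j → trans (fill≡ i j) (entry-table (fill (wordOf x)) i j))

    fill-toMarked : ∀ t inc d → incFrom (toMarked t (k≤mn t inc) d) ≡ (t , inc)
    fill-toMarked t inc (decomposition w _ wf _ _ fill≡) =
      Σ-T-≡ (table-entry t _ (λ i j → trans (cong (λ w → fill w i j) (attachFlags-flagsOf w wf)) (fill≡ i j)))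

    Inc↔Fibre : Inc m n k ↔ Fibre missing k
    Inc↔Fibre = mk↔ₛ′ incTo incFrom to∘from from∘to
      where
      to∘from : ∀ y → incTo (incFrom y) ≡ y
      to∘from y@(x , e) = toMarked-fill x e (decomposeInc (table (fill (wordOf x))) inc) (k≤mn (table (fill (wordOf x))) inc)
        where inc = proj₂ (incFrom y)
      from∘to : ∀ y → incFrom (incTo y) ≡ y
      from∘to (t , inc) = fill-toMarked t inc (decomposeInc t inc)

  -- An ascent x < y (newest first) is a step x taken while cnt x ≥ cnt y ≥ 1, so never the first
  -- step x; there are at most n − 1 such steps for each of the rows x < m − 1.
  ascentBudget : List (Fin m) → ℕ
  ascentBudget u = sumFin {a} (λ r → cnt (inject₁ r) u ∸ 1)

  ascentBudget-∷ : ∀ x u → ascentBudget u ≤ ascentBudget (x ∷ u)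
  ascentBudget-∷ x u = sumFin-mono (λ r → ∸-monoˡ-≤ 1 (cnt-∷-≤ x (inject₁ r) u))

  ascentBudget-ascent : ∀ x y u → toℕ x < toℕ y → T (tailsInRegion (y ∷ u)) →
    suc (ascentBudget (y ∷ u)) ≤ ascentBudget (x ∷ y ∷ u)
  ascentBudget-ascent x y u x<y reg =
    sumFin-mono-< r (λ r' → ∸-monoˡ-≤ 1 (cnt-∷-≤ x (inject₁ r') (y ∷ u)))
                  (subst (λ z → cnt z (y ∷ u) ∸ 1 < cnt z (x ∷ y ∷ u) ∸ 1) (sym r≡x) grows)
    where
    x<a : toℕ x < a
    x<a = <-≤-trans x<y (s≤s⁻¹ (Fin.toℕ<n y))
    r = fromℕ< x<a
    r≡x : inject₁ r ≡ x
    r≡x = Fin.toℕ-injective (trans (Fin.toℕ-inject₁ r) (Fin.toℕ-fromℕ< x<a))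
    1≤cnt : 1 ≤ cnt x (y ∷ u)
    1≤cnt = ≤-trans (subst (1 ≤_) (sym (cnt-here y u)) (s≤s z≤n)) (tailsInRegion⇒InRegion (y ∷ u) reg x y x<y)
    grows : cnt x (y ∷ u) ∸ 1 < cnt x (x ∷ y ∷ u) ∸ 1
    grows rewrite cnt-here x (y ∷ u) = ∸1< 1≤cnt
      where
      ∸1< : ∀ {c} → 1 ≤ c → c ∸ 1 < c
      ∸1< (s≤s _) = ≤-refl

  ascentsᴿ≤ascentBudget : ∀ u → T (tailsInRegion u) → ascentsᴿ u ≤ ascentBudget u
  ascentsᴿ≤ascentBudget []          _   = z≤n
  ascentsᴿ≤ascentBudget (x ∷ [])    _   = z≤n
  ascentsᴿ≤ascentBudget (x ∷ y ∷ u) reg =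
    ≤-trans (+-monoʳ-≤ (bit (toℕ x <ᵇ toℕ y)) (ascentsᴿ≤ascentBudget (y ∷ u) reg'))
            (by-comparison (toℕ x <? toℕ y))
    where
    reg' = tailsInRegion-tail x (y ∷ u) reg
    by-comparison : Dec (toℕ x < toℕ y) → bit (toℕ x <ᵇ toℕ y) + ascentBudget (y ∷ u) ≤ ascentBudget (x ∷ y ∷ u)
    by-comparison (yes x<y) rewrite <ᵇ-true (toℕ x) (toℕ y) x<y = ascentBudget-ascent x y u x<y reg'
    by-comparison (no  x≮y) rewrite <ᵇ-false (toℕ x) (toℕ y) x≮y = ascentBudget-∷ x (y ∷ u)

  ascentCount : MarkedPath → ℕ
  ascentCount (u , _ , _) = ascentsᴿ u

  ascentCount≤ : ∀ x → ascentCount x ≤ a * b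
  ascentCount≤ (u , (reg , full-u , _) , _) = ≤-trans (ascentsᴿ≤ascentBudget u reg)
    (≤-reflexive (trans (sumFin-cong {a} (λ r → cong (_∸ 1) (cnt≡n (inject₁ r)))) (sumFin-const a b)))
    where
    cnt≡n : ∀ j → cnt j u ≡ n
    cnt≡n j = ≡ᵇ⇒≡ (cnt j u) n (allFin-elim m (λ j → cnt j u ≡ᵇ n) full-u j)

  cnt-++ : ∀ (j : Fin m) xs ys → cnt j (xs ++ ys) ≡ cnt j xs + cnt j ys
  cnt-++ j []       ys = refl
  cnt-++ j (x ∷ xs) ys =
    trans (cong (_ +_) (cnt-++ j xs ys)) (sym (+-assoc (if toℕ x ≡ᵇ toℕ j then 1 else 0) (cnt j xs) (cnt j ys)))

  cnt-reverse : ∀ (j : Fin m) xs → cnt j (reverse xs) ≡ cnt j xs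
  cnt-reverse j []       = refl
  cnt-reverse j (x ∷ xs) = begin
    cnt j (reverse (x ∷ xs))                 ≡⟨ cong (cnt j) (List.unfold-reverse x xs) ⟩
    cnt j (reverse xs ++ x ∷ [])             ≡⟨ cnt-++ j (reverse xs) (x ∷ []) ⟩
    cnt j (reverse xs) + cnt j (x ∷ [])      ≡⟨ cong₂ _+_ (cnt-reverse j xs) (+-identityʳ _) ⟩
    cnt j xs + (if toℕ x ≡ᵇ toℕ j then 1 else 0) ≡⟨ +-comm (cnt j xs) _ ⟩
    cnt j (x ∷ xs)                           ∎
    where open ≡-Reasoning

  inRegion-cong : ∀ w w' → (∀ j → cnt j w ≡ cnt j w') → inRegion m w ≡ inRegion m w'
  inRegion-cong w w' cnt≡ = allFin-cong m (λ j → allFin-cong m (λ j' →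
    cong₂ (λ c' c → (toℕ j <ᵇ toℕ j') ⇒ᵇ (c' ≤ᵇ c)) (cnt≡ j') (cnt≡ j)))

  inRegion-[] : inRegion m [] ≡ true
  inRegion-[] = Equivalence.to T-≡ (InRegion⇒inRegion [] (λ _ _ _ → z≤n))

  take-++ˡ : ∀ {A : Set} l (ys zs : List A) → l ≤ length ys → take l (ys ++ zs) ≡ take l ys
  take-++ˡ zero    ys       zs _         = refl
  take-++ˡ (suc l) (y ∷ ys) zs (s≤s l≤) = cong (y ∷_) (take-++ˡ l ys zs l≤)

  prefixesInRegion≡tailsInRegion : ∀ u → allBelow (suc (length u)) (λ l → inRegion m (take l (reverse u))) ≡ tailsInRegion u
  prefixesInRegion≡tailsInRegion []      = cong (true ∧_) inRegion-[]
  prefixesInRegion≡tailsInRegion (x ∷ u) =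
    trans (cong₂ _∧_ (trans (allBelow-cong (suc (length u)) shorter) (prefixesInRegion≡tailsInRegion u)) whole)
          (∧-comm (tailsInRegion u) _)
    where
    shorter : ∀ l → l < suc (length u) → inRegion m (take l (reverse (x ∷ u))) ≡ inRegion m (take l (reverse u))
    shorter l l< = cong (inRegion m) (trans (cong (take l) (List.unfold-reverse x u))
                     (take-++ˡ l (reverse u) (x ∷ []) (subst (l ≤_) (sym (List.length-reverse u)) (s≤s⁻¹ l<))))
    whole : inRegion m (take (suc (length u)) (reverse (x ∷ u))) ≡ inRegion m (x ∷ u)
    whole = trans (cong (inRegion m)
                        (List.take-all (suc (length u)) (reverse (x ∷ u)) (≤-reflexive (List.length-reverse (x ∷ u)))))
                  (inRegion-cong (reverse (x ∷ u)) (x ∷ u) (λ j → cnt-reverse j (x ∷ u)))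

  isPath≡ : ∀ (p : Vec (Fin m) (m * n)) →
    isPath m n p ≡ tailsInRegion (reverse (toList p)) ∧ allFin m (λ j → cnt j (reverse (toList p)) ≡ᵇ n)
  isPath≡ p = cong₂ _∧_ prefixes (allFin-cong m (λ j → cong (_≡ᵇ n) (sym (cnt-reverse j (toList p)))))
    where
    prefixes : allBelow (suc (m * n)) (λ l → inRegion m (take l (toList p))) ≡ tailsInRegion (reverse (toList p))
    prefixes = trans (cong₂ (λ N ys → allBelow (suc N) (λ l → inRegion m (take l ys)))
                            (trans (sym (Vec.length-toList p)) (sym (List.length-reverse (toList p))))
                            (sym (List.reverse-involutive (toList p))))
                     (prefixesInRegion≡tailsInRegion (reverse (toList p)))

  ascentsᴿ-foldl : ∀ (x : Fin m) w acc → ascentsᴿ (foldl (λ xs y → y ∷ xs) (x ∷ acc) w) ≡ ascents (x ∷ w) + ascentsᴿ (x ∷ acc)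
  ascentsᴿ-foldl x []      acc = refl
  ascentsᴿ-foldl x (y ∷ w) acc = trans (ascentsᴿ-foldl y w (x ∷ acc))
    (trans (sym (+-assoc (ascents (y ∷ w)) _ (ascentsᴿ (x ∷ acc)))) (cong (_+ ascentsᴿ (x ∷ acc)) (+-comm (ascents (y ∷ w)) _)))

  ascents≡ascentsᴿ-reverse : ∀ xs → ascents xs ≡ ascentsᴿ (reverse xs)
  ascents≡ascentsᴿ-reverse []      = refl
  ascents≡ascentsᴿ-reverse (x ∷ w) = sym (trans (ascentsᴿ-foldl x w []) (+-identityʳ _))

  module PathBijection (ℓ : ℕ) where

    pathOf : ∀ u → length u ≡ m * n → Vec (Fin m) (m * n)
    pathOf u length≡ = cast (trans (List.length-reverse u) length≡) (fromList (reverse u))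

    reverse-pathOf : ∀ u length≡ → reverse (toList (pathOf u length≡)) ≡ u
    reverse-pathOf u length≡ =
      trans (cong reverse (trans (Vec.toList-cast (trans (List.length-reverse u) length≡) (fromList (reverse u)))
                                 (Vec.toList∘fromList (reverse u))))
            (List.reverse-involutive u)

    pathOf-reverse : ∀ p length≡ → pathOf (reverse (toList p)) length≡ ≡ p
    pathOf-reverse p length≡ = cast-fromList (List.reverse-involutive (toList p))
      where
      cast-fromList : ∀ {xs} .{e : length xs ≡ m * n} → xs ≡ toList p → cast e (fromList xs) ≡ p
      cast-fromList refl = Vec.fromList∘toList p

    ascentsᴿ-path : ∀ p → T (isPath m n p ∧ (ascents (toList p) ≡ᵇ ℓ)) → ascentsᴿ (reverse (toList p)) ≡ ℓ
    ascentsᴿ-path p path = trans (sym (ascents≡ascentsᴿ-reverse (toList p))) (≡ᵇ⇒≡ _ _ (proj₂ (T-∧⁻ {isPath m n p} path)))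

    mark : (PathAsc m n ℓ × Vec Bool ℓ) → Fibre ascentCount ℓ
    mark ((p , path) , marks) = (u , (reg , full-u , length≡) , subst (Vec Bool) (sym asc≡) marks) , asc≡
      where
      u = reverse (toList p)
      path′ = subst T (isPath≡ p) (proj₁ (T-∧⁻ {isPath m n p} path))
      reg = proj₁ (T-∧⁻ {tailsInRegion u} path′)
      full-u = proj₂ (T-∧⁻ {tailsInRegion u} path′)
      length≡ = trans (List.length-reverse (toList p)) (Vec.length-toList p)
      asc≡ = ascentsᴿ-path p path

    unmark : Fibre ascentCount ℓ → PathAsc m n ℓ × Vec Bool ℓ
    unmark ((u , (reg , full-u , length≡) , marks) , asc≡) = (p , T-∧⁺ {isPath m n p} path asc) , subst (Vec Bool) asc≡ marks
      where
      p = pathOf u length≡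
      path : T (isPath m n p)
      path = subst T (sym (isPath≡ p))
               (subst (λ z → T (tailsInRegion z ∧ allFin m (λ j → cnt j z ≡ᵇ n))) (sym (reverse-pathOf u length≡))
                      (T-∧⁺ reg full-u))
      asc : T (ascents (toList p) ≡ᵇ ℓ)
      asc = ≡⇒≡ᵇ _ _ (trans (ascents≡ascentsᴿ-reverse (toList p)) (trans (cong ascentsᴿ (reverse-pathOf u length≡)) asc≡))

    Fibre-ascentCount-≡ : ∀ {u u'} (u'≡u : u' ≡ u) (p : IsPathᴿ u) (p' : IsPathᴿ u') (marks : Vec Bool (ascentsᴿ u))
      (asc≡ : ascentsᴿ u ≡ ℓ) (asc≡' : ascentsᴿ u' ≡ ℓ) →
      _≡_ {A = Fibre ascentCount ℓ} ((u' , p' , subst (Vec Bool) (sym asc≡') (subst (Vec Bool) asc≡ marks)) , asc≡')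
                                    ((u , p , marks) , asc≡)
    Fibre-ascentCount-≡ {u} refl p p' marks asc≡ asc≡' rewrite ≡-irrelevant asc≡' asc≡ | IsPathᴿ-irrelevant u p' p =
      cong (λ marks' → (u , p , marks') , asc≡) (subst-sym-subst asc≡)

    PathAsc×marks↔Fibre : (PathAsc m n ℓ × Vec Bool ℓ) ↔ Fibre ascentCount ℓ
    PathAsc×marks↔Fibre = mk↔ₛ′ mark unmark mark∘unmark unmark∘mark
      where
      mark∘unmark : ∀ y → mark (unmark y) ≡ y
      mark∘unmark ((u , p@(_ , _ , length≡) , marks) , asc≡) = Fibre-ascentCount-≡ (reverse-pathOf u length≡) p _ marks asc≡ _
      unmark∘mark : ∀ y → unmark (mark y) ≡ y
      unmark∘mark ((p , path) , marks) =
        cong₂ _,_ (Σ-T-≡ (pathOf-reverse p (trans (List.length-reverse (toList p)) (Vec.length-toList p))))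
                  (subst-subst-sym (ascentsᴿ-path p path))

corollary2p8 : (m n : ℕ) → 2 ≤ m → 1 ≤ n →
    (a b : ℕ → ℕ) →
    ((k : ℕ) → Inc m n k ↔ Fin (a k)) →
    ((ℓ : ℕ) → PathAsc m n ℓ ↔ Fin (b ℓ)) →
    sumTo ((m ∸ 1) * (n ∸ 1)) a ≡ sumTo ((m ∸ 1) * (n ∸ 1)) (λ ℓ → b ℓ * 2 ^ ℓ)
corollary2p8 (suc a′) (suc b′) _ _ a b Inc↔a PathAsc↔b =
  sumTo-double-count missing ascentCount (a′ * b′) a (λ ℓ → b ℓ * 2 ^ ℓ) missing≤ ascentCount≤
    (λ k → ↔-trans (↔-sym (IncBijection.Inc↔Fibre k)) (Inc↔a k))
    (λ ℓ → ↔-trans (↔-sym (PathBijection.PathAsc×marks↔Fibre ℓ))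
             (↔-trans (PathAsc↔b ℓ ×-↔ Vec-Bool↔Fin-2^ ℓ) (↔-sym Fin.*↔×)))
  where open Rectangle a′ b′
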